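{- Let $p\ge5$ be a prime and $k$ an integer with $1\le k$, $2k\le p-3$, and put $t=p-1-2k$. Then \[ \begin{aligned} (-1)^k4^{2k-1}E_t\equiv{}&16^tS_t(0,\tfrac1{64})+2^tS_t(\tfrac38,\tfrac7{16})+(2^t+4^t)S_t(\tfrac7{16},\tfrac{15}{32})\\ &+(2^t+4^t+8^t)S_t(\tfrac{15}{32},\tfrac{31}{64})+(2^t+4^t+8^t+16^t)S_t(\tfrac{31}{64},\tfrac12)\pmod p. \end{aligned} \]
   Context: $E_n$ denotes the Euler numbers, $\sec z=\sum_{n\ge0}E_n\frac{z^n}{n!}$. For a prime $p$, an integer $\ell$ and reals $0\le x<y\le1$, $S_\ell(x,y)=\sum_{s\in\mathbb{Z},\ xp<s<yp}s^\ell$, considered modulo $p$. -}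

module Defs where

open import Data.Nat as ℕ using (ℕ; zero; suc; _≤ᵇ_; _<ᵇ_; _∸_)
open import Data.Nat.Combinatorics using (_C_)
open import Data.Integer as ℤ using (ℤ; +_; -_; _+_; _*_; _^_)
open import Data.Bool using (if_then_else_; _∧_)

sumTo : ℕ → (ℕ → ℤ) → ℤ
sumTo zero    f = + 0
sumTo (suc n) f = sumTo n f + f n

-- Euler (secant) numbers, sec z = Σ E_n z^n / n!.
-- Coefficient comparison in cos z · sec z = 1 gives, for n ≥ 1,
--   E_n = Σ_{k ≥ 1, 2k ≤ n} (-1)^(k+1) C(n,2k) E_(n-2k),   E_0 = 1.
-- eulerUpTo n i is correct for all i ≤ n.
eulerUpTo : ℕ → ℕ → ℤ
eulerUpTo zero i = if i ℕ.≡ᵇ 0 then + 1 else + 0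
eulerUpTo (suc n) i =
  if i ≤ᵇ n then eulerUpTo n i
  else sumTo (suc (suc n)) (λ k →
         if (1 ≤ᵇ k) ∧ (2 ℕ.* k ≤ᵇ suc n)
         then (- (ℤ.-1ℤ ^ k)) * (+ (suc n C (2 ℕ.* k))) * eulerUpTo n (suc n ∸ 2 ℕ.* k)
         else + 0)

E : ℕ → ℤ
E n = eulerUpTo n n

-- S ℓ (a/b, c/d) over prime p: Σ_{s ∈ ℤ, (a/b)p < s < (c/d)p} s^ℓ, for
-- 0 ≤ a/b < c/d ≤ 1 (so only 0 ≤ s ≤ p can occur).
-- Condition (a/b)p < s < (c/d)p  ⇔  a·p < b·s  ∧  d·s < c·p  (b, d > 0).
S : (p ℓ a b c d : ℕ) → ℤ
S p ℓ a b c d = sumTo (suc p) (λ s →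
  if (a ℕ.* p <ᵇ b ℕ.* s) ∧ (d ℕ.* s <ᵇ c ℕ.* p) then (+ s) ^ ℓ else + 0)

-- Let sech_n be the coefficients of sech z (signed Euler numbers) and Q_n(x) those of e^{xz} sech z.
-- From cosh z · sech z = 1 one gets the reflection formula Q_n(y - 1) + Q_n(y + 1) = 2 y^n, so for
-- p = 2m + 1 and even t the alternating sum 2 Σ_{i<m} (-1)^i (2i+1)^t telescopes to Q_t(0) - (-1)^m Q_t(2m),
-- which is ≡ sech_t (mod p) because Q_t(2m) ≡ Q_t(-1) = 0. Reflecting s ↦ p - s turns the odd powers
-- into even ones, and splitting by parity (with Σ_{s<p} s^t ≡ 0) gives sech_t ≡ 4 (-1)^m 4^t S_t(0, 1/4).
-- The same parity split gives the doubling rule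
--   S_t(a/N, c/N) ≡ 2^t (S_t(a/2N, c/2N) + S_t((N-c)/2N, (N-a)/2N)),
-- which for N = 4, 8, 16, 32 expands S_t(0, 1/4) into the dyadic intervals of the statement;
-- Fermat's 2^(p-1) ≡ 1 removes the remaining powers of 2.

module Submission where

open import Defs
open import Data.Bool using (Bool; true; false; if_then_else_; _∧_; T)
open import Data.Bool.Properties using (∧-comm; ∧-zeroʳ; T-≡)
open import Function.Bundles using (Equivalence)
open import Data.Nat.Induction using (<-rec)
open import Data.Empty using (⊥-elim)
open import Data.Nat as ℕ using (ℕ; zero; suc; _≤_; _<_; _∸_; z≤n; s≤s; _≤ᵇ_; _<ᵇ_)
import Data.Nat.Properties as ℕₚ
import Data.Nat.Tactic.RingSolver as ℕ-Solver
open import Data.Nat.Combinatorics using (_C_)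
import Data.Nat.Combinatorics as ℕC
open import Data.Nat.Primality using (Prime; euclidsLemma; prime⇒irreducible)
import Data.Nat.Divisibility as ℕ∣
open import Data.Integer as ℤ using (ℤ; +_; -_; _+_; _-_; _*_; _^_; -1ℤ)
import Data.Integer.Properties as ℤₚ
open import Data.Integer.Divisibility using (_∣_)
import Data.Integer.Divisibility.Signed as ℤ∣
open import Data.Integer.Tactic.RingSolver using (solve-∀)
open import Data.Product using (Σ; _,_)
open import Data.Sum using (inj₁; inj₂)
open import Level using (0ℓ)
open import Relation.Binary.Bundles using (Setoid)
open import Relation.Binary.Definitions using (tri<; tri≈; tri>)
import Relation.Binary.Reasoning.Setoid as SetoidReasoning
open import Relation.Binary.PropositionalEquality
  using (_≡_; _≢_; refl; sym; trans; cong; cong₂; subst; subst₂; module ≡-Reasoning)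
open import Relation.Nullary using (¬_; yes; no)

sum-cong : ∀ n {f g : ℕ → ℤ} → (∀ i → i < n → f i ≡ g i) → sumTo n f ≡ sumTo n g
sum-cong zero    f≡g = refl
sum-cong (suc n) f≡g = cong₂ _+_ (sum-cong n (λ i i<n → f≡g i (ℕₚ.m<n⇒m<1+n i<n))) (f≡g n ℕₚ.≤-refl)

sum-+ : ∀ n (f g : ℕ → ℤ) → sumTo n (λ i → f i + g i) ≡ sumTo n f + sumTo n g
sum-+ zero    f g = refl
sum-+ (suc n) f g rewrite sum-+ n f g = lemma (sumTo n f) (sumTo n g) (f n) (g n)
  where
  lemma : ∀ a b c d → a + b + (c + d) ≡ a + c + (b + d)
  lemma = solve-∀

sum-*ˡ : ∀ n (c : ℤ) (f : ℕ → ℤ) → sumTo n (λ i → c * f i) ≡ c * sumTo n f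
sum-*ˡ zero    c f = sym (ℤₚ.*-zeroʳ c)
sum-*ˡ (suc n) c f rewrite sum-*ˡ n c f = sym (ℤₚ.*-distribˡ-+ c (sumTo n f) (f n))

sum-- : ∀ n (f g : ℕ → ℤ) → sumTo n (λ i → f i - g i) ≡ sumTo n f - sumTo n g
sum-- zero    f g = refl
sum-- (suc n) f g rewrite sum-- n f g = lemma (sumTo n f) (sumTo n g) (f n) (g n)
  where
  lemma : ∀ a b c d → a - b + (c - d) ≡ a + c - (b + d)
  lemma = solve-∀

sum-zero : ∀ n (f : ℕ → ℤ) → (∀ i → i < n → f i ≡ + 0) → sumTo n f ≡ + 0
sum-zero n f f≡0 = trans (sum-cong n f≡0) (zeros n)
  where
  zeros : ∀ n → sumTo n (λ _ → + 0) ≡ + 0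
  zeros zero    = refl
  zeros (suc n) = cong (_+ + 0) (zeros n)

sum-suc : ∀ n (f : ℕ → ℤ) → sumTo (suc n) f ≡ f 0 + sumTo n (λ i → f (suc i))
sum-suc zero    f = ℤₚ.+-comm (+ 0) (f 0)
sum-suc (suc n) f rewrite sum-suc n f = ℤₚ.+-assoc (f 0) _ (f (suc n))

sum-++ : ∀ m n (f : ℕ → ℤ) → sumTo (m ℕ.+ n) f ≡ sumTo m f + sumTo n (λ i → f (m ℕ.+ i))
sum-++ m zero    f rewrite ℕₚ.+-identityʳ m = sym (ℤₚ.+-identityʳ _)
sum-++ m (suc n) f rewrite ℕₚ.+-suc m n | sum-++ m n f = ℤₚ.+-assoc (sumTo m f) _ _

sum-vanishing-tail : ∀ {n N} (f : ℕ → ℤ) → n ≤ N → (∀ i → n ≤ i → f i ≡ + 0) → sumTo N f ≡ sumTo n f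
sum-vanishing-tail {n} {N} f n≤N tail≡0 = begin
  sumTo N f                                               ≡⟨ cong (λ M → sumTo M f) (ℕₚ.m+[n∸m]≡n n≤N) ⟨
  sumTo (n ℕ.+ (N ∸ n)) f                                 ≡⟨ sum-++ n (N ∸ n) f ⟩
  sumTo n f + sumTo (N ∸ n) (λ i → f (n ℕ.+ i))           ≡⟨ cong (_+_ (sumTo n f)) (sum-zero (N ∸ n) _ (λ i _ → tail≡0 (n ℕ.+ i) (ℕₚ.m≤m+n n i))) ⟩
  sumTo n f + + 0                                         ≡⟨ ℤₚ.+-identityʳ _ ⟩
  sumTo n f                                               ∎
  where open ≡-Reasoning

sum-reverse : ∀ n (f : ℕ → ℤ) → sumTo n f ≡ sumTo n (λ i → f (n ∸ suc i))
sum-reverse zero    f = refl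
sum-reverse (suc n) f = begin
  sumTo n f + f n                             ≡⟨ cong (_+ f n) (sum-reverse n f) ⟩
  sumTo n (λ i → f (n ∸ suc i)) + f n         ≡⟨ ℤₚ.+-comm _ (f n) ⟩
  f n + sumTo n (λ i → f (n ∸ suc i))         ≡⟨ sum-suc n (λ i → f (n ∸ i)) ⟨
  sumTo (suc n) (λ i → f (n ∸ i))             ∎
  where open ≡-Reasoning

sum-evenOdd : ∀ n (f : ℕ → ℤ) →
  sumTo (2 ℕ.* n) f ≡ sumTo n (λ u → f (2 ℕ.* u)) + sumTo n (λ u → f (suc (2 ℕ.* u)))
sum-evenOdd zero    f = refl
sum-evenOdd (suc n) f = begin
  sumTo (2 ℕ.* suc n) f                         ≡⟨ cong (λ k → sumTo k f) (ℕₚ.*-suc 2 n) ⟩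
  sumTo (2 ℕ.* n) f + f (2 ℕ.* n) + f (suc (2 ℕ.* n))
    ≡⟨ cong (λ z → z + f (2 ℕ.* n) + f (suc (2 ℕ.* n))) (sum-evenOdd n f) ⟩
  evens + odds + f (2 ℕ.* n) + f (suc (2 ℕ.* n)) ≡⟨ lemma evens odds (f (2 ℕ.* n)) (f (suc (2 ℕ.* n))) ⟩
  evens + f (2 ℕ.* n) + (odds + f (suc (2 ℕ.* n))) ∎
  where
  open ≡-Reasoning
  evens odds : ℤ
  evens = sumTo n (λ u → f (2 ℕ.* u))
  odds  = sumTo n (λ u → f (suc (2 ℕ.* u)))
  lemma : ∀ a b c d → a + b + c + d ≡ a + c + (b + d)
  lemma = solve-∀

sum-evenOdd′ : ∀ n (f : ℕ → ℤ) →
  sumTo (suc (suc (2 ℕ.* n))) f ≡ sumTo (suc n) (λ u → f (2 ℕ.* u)) + sumTo (suc n) (λ u → f (suc (2 ℕ.* u)))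
sum-evenOdd′ n f = trans (cong (λ k → sumTo k f) (sym (ℕₚ.*-suc 2 n))) (sum-evenOdd (suc n) f)

sum-swap : ∀ n k (f : ℕ → ℕ → ℤ) →
  sumTo n (λ i → sumTo k (λ j → f i j)) ≡ sumTo k (λ j → sumTo n (λ i → f i j))
sum-swap zero    k f = sym (sum-zero k _ (λ _ _ → refl))
sum-swap (suc n) k f rewrite sum-swap n k f = sym (sum-+ k (λ j → sumTo n (λ i → f i j)) (λ j → f n j))

sum-telescope : ∀ n (g : ℕ → ℤ) → sumTo n (λ i → g (suc i) - g i) ≡ g n - g 0
sum-telescope zero    g = sym (ℤₚ.+-inverseʳ (g 0))
sum-telescope (suc n) g rewrite sum-telescope n g = lemma (g n) (g (suc n)) (g 0)
  where
  lemma : ∀ a b c → a - c + (b - a) ≡ b - c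
  lemma = solve-∀

module Modulo (P : ℤ) where

  infix 4 _≈_
  record _≈_ (x y : ℤ) : Set where
    constructor _,_
    field
      quotient : ℤ
      equation : x ≡ y + quotient * P

  ≈-refl : ∀ {x} → x ≈ x
  ≈-refl {x} = + 0 , sym (ℤₚ.+-identityʳ x)

  ≡⇒≈ : ∀ {x y} → x ≡ y → x ≈ y
  ≡⇒≈ refl = ≈-refl

  ≈-sym : ∀ {x y} → x ≈ y → y ≈ x
  ≈-sym {x} {y} (q , refl) = - q , lemma y q P
    where
    lemma : ∀ y q P → y ≡ y + q * P + - q * P
    lemma = solve-∀

  ≈-trans : ∀ {x y z} → x ≈ y → y ≈ z → x ≈ z
  ≈-trans {z = z} (q , refl) (r , refl) = q + r , lemma z q r P
    where
    lemma : ∀ z q r P → z + r * P + q * P ≡ z + (q + r) * P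
    lemma = solve-∀

  ≈-setoid : Setoid 0ℓ 0ℓ
  ≈-setoid = record
    { Carrier       = ℤ
    ; _≈_           = _≈_
    ; isEquivalence = record { refl = ≈-refl ; sym = ≈-sym ; trans = ≈-trans }
    }

  module ≈-Reasoning = SetoidReasoning ≈-setoid

  +-cong : ∀ {x x′ y y′} → x ≈ x′ → y ≈ y′ → x + y ≈ x′ + y′
  +-cong {x′ = x′} {y′ = y′} (q , refl) (r , refl) = q + r , lemma x′ y′ q r P
    where
    lemma : ∀ a b q r P → a + q * P + (b + r * P) ≡ a + b + (q + r) * P
    lemma = solve-∀

  *-cong : ∀ {x x′ y y′} → x ≈ x′ → y ≈ y′ → x * y ≈ x′ * y′
  *-cong {x′ = x′} {y′ = y′} (q , refl) (r , refl) = q * y′ + x′ * r + q * r * P , lemma x′ y′ q r P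
    where
    lemma : ∀ a b q r P → (a + q * P) * (b + r * P) ≡ a * b + (q * b + a * r + q * r * P) * P
    lemma = solve-∀

  -‿cong : ∀ {x y} → x ≈ y → - x ≈ - y
  -‿cong {y = y} (q , refl) = - q , lemma y q P
    where
    lemma : ∀ y q P → - (y + q * P) ≡ - y + - q * P
    lemma = solve-∀

  -‿cong₂ : ∀ {x x′ y y′} → x ≈ x′ → y ≈ y′ → x - y ≈ x′ - y′
  -‿cong₂ x≈x′ y≈y′ = +-cong x≈x′ (-‿cong y≈y′)

  *-congˡ : ∀ c {x y} → x ≈ y → c * x ≈ c * y
  *-congˡ c = *-cong (≈-refl {c})

  ^-congˡ : ∀ {x y} n → x ≈ y → x ^ n ≈ y ^ n
  ^-congˡ zero    x≈y = ≈-refl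
  ^-congˡ (suc n) x≈y = *-cong x≈y (^-congˡ n x≈y)

  sum-cong≈ : ∀ n {f g : ℕ → ℤ} → (∀ i → i < n → f i ≈ g i) → sumTo n f ≈ sumTo n g
  sum-cong≈ zero    f≈g = ≈-refl
  sum-cong≈ (suc n) f≈g = +-cong (sum-cong≈ n (λ i i<n → f≈g i (ℕₚ.m<n⇒m<1+n i<n))) (f≈g n ℕₚ.≤-refl)

  P≈0 : P ≈ + 0
  P≈0 = + 1 , sym (trans (ℤₚ.+-identityˡ _) (ℤₚ.*-identityˡ P))

  ≈⇒∣ : ∀ {x y} → x ≈ y → P ∣ (x - y)
  ≈⇒∣ {y = y} (q , refl) = ℤ∣.∣⇒∣ᵤ (ℤ∣.divides q (lemma y q P))
    where
    lemma : ∀ y q P → y + q * P - y ≡ q * P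
    lemma = solve-∀

-- Exponential generating functions

Seq : Set
Seq = ℕ → ℤ

infixl 7 _⋆_
_⋆_ : Seq → Seq → Seq
(a ⋆ b) n = sumTo (suc n) (λ i → + (n C i) * a i * b (n ∸ i))

∂ : Seq → Seq
∂ a i = a (suc i)

δ : Seq
δ zero    = + 1
δ (suc _) = + 0

powers : ℤ → Seq
powers x n = x ^ n

⋆-zero : ∀ a b → (a ⋆ b) 0 ≡ a 0 * b 0
⋆-zero a b = trans (ℤₚ.+-identityˡ _) (cong (_* b 0) (ℤₚ.*-identityˡ (a 0)))

⋆-cong : ∀ {a a′ b b′ : Seq} → (∀ i → a i ≡ a′ i) → (∀ i → b i ≡ b′ i) → ∀ n → (a ⋆ b) n ≡ (a′ ⋆ b′) n
⋆-cong a≡a′ b≡b′ n = sum-cong (suc n) (λ i _ → cong₂ (λ x y → + (n C i) * x * y) (a≡a′ i) (b≡b′ (n ∸ i)))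

⋆-leibniz : ∀ a b n → (a ⋆ b) (suc n) ≡ (∂ a ⋆ b) n + (a ⋆ ∂ b) n
⋆-leibniz a b n = begin
  (a ⋆ b) (suc n)
    ≡⟨ sum-suc (suc n) _ ⟩
  first + sumTo (suc n) (λ i → + (suc n C suc i) * a (suc i) * b (n ∸ i))
    ≡⟨ cong (_+_ first) (trans (sum-cong (suc n) (λ i _ → pascal i)) (sum-+ (suc n) _ _)) ⟩
  first + ((∂ a ⋆ b) n + sumTo (suc n) (λ i → + (n C suc i) * a (suc i) * b (n ∸ i)))
    ≡⟨ cong (λ z → first + ((∂ a ⋆ b) n + z)) lastVanishes ⟩
  first + ((∂ a ⋆ b) n + rest)
    ≡⟨ lemma first ((∂ a ⋆ b) n) rest ⟩
  (∂ a ⋆ b) n + (first + rest)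
    ≡⟨ cong (_+_ ((∂ a ⋆ b) n)) (sum-suc n (λ i → + (n C i) * a i * b (suc (n ∸ i)))) ⟨
  (∂ a ⋆ b) n + (a ⋆ ∂ b) n
    ∎
  where
  open ≡-Reasoning
  first rest : ℤ
  first = + 1 * a 0 * b (suc n)
  rest  = sumTo n (λ i → + (n C suc i) * a (suc i) * b (suc (n ∸ suc i)))
  pascal : ∀ i → + (suc n C suc i) * a (suc i) * b (n ∸ i)
               ≡ + (n C i) * a (suc i) * b (n ∸ i) + + (n C suc i) * a (suc i) * b (n ∸ i)
  pascal i rewrite sym (ℕC.nCk+nC[k+1]≡[n+1]C[k+1] n i) | ℤₚ.pos-+ (n C i) (n C suc i) =
    distrib (+ (n C i)) (+ (n C suc i)) (a (suc i)) (b (n ∸ i))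
    where
    distrib : ∀ x y u v → (x + y) * u * v ≡ x * u * v + y * u * v
    distrib = solve-∀
  lastVanishes : sumTo (suc n) (λ i → + (n C suc i) * a (suc i) * b (n ∸ i)) ≡ rest
  lastVanishes rewrite ℕC.k>n⇒nCk≡0 (ℕₚ.n<1+n n) =
    trans (cong (_+_ (sumTo n (λ i → + (n C suc i) * a (suc i) * b (n ∸ i)))) (ℤₚ.*-zeroˡ (b (n ∸ n))))
    (trans (ℤₚ.+-identityʳ _)
           (sum-cong n (λ i i<n → cong (λ z → + (n C suc i) * a (suc i) * b z) (ℕₚ.+-∸-assoc 1 i<n))))
  lemma : ∀ x y z → x + (y + z) ≡ y + (x + z)
  lemma = solve-∀

⋆-comm : ∀ n a b → (a ⋆ b) n ≡ (b ⋆ a) n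
⋆-comm zero    a b = trans (⋆-zero a b) (trans (ℤₚ.*-comm (a 0) (b 0)) (sym (⋆-zero b a)))
⋆-comm (suc n) a b
  rewrite ⋆-leibniz a b n | ⋆-leibniz b a n | ⋆-comm n (∂ a) b | ⋆-comm n a (∂ b) =
  ℤₚ.+-comm ((b ⋆ ∂ a) n) ((∂ b ⋆ a) n)

⋆-distribˡ-+ : ∀ n a b c → (a ⋆ (λ i → b i + c i)) n ≡ (a ⋆ b) n + (a ⋆ c) n
⋆-distribˡ-+ n a b c = trans (sum-cong (suc n) (λ i _ → lemma (+ (n C i)) (a i) (b (n ∸ i)) (c (n ∸ i))))
                              (sum-+ (suc n) _ _)
  where
  lemma : ∀ x u v w → x * u * (v + w) ≡ x * u * v + x * u * w
  lemma = solve-∀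

⋆-distribʳ-+ : ∀ n a b c → ((λ i → a i + b i) ⋆ c) n ≡ (a ⋆ c) n + (b ⋆ c) n
⋆-distribʳ-+ n a b c =
  trans (⋆-comm n _ c) (trans (⋆-distribˡ-+ n c a b) (cong₂ _+_ (⋆-comm n c a) (⋆-comm n c b)))

⋆-scaleʳ : ∀ n a b k → (a ⋆ (λ i → k * b i)) n ≡ k * (a ⋆ b) n
⋆-scaleʳ n a b k = trans (sum-cong (suc n) (λ i _ → lemma (+ (n C i)) (a i) (b (n ∸ i)) k)) (sum-*ˡ (suc n) k _)
  where
  lemma : ∀ x u v k → x * u * (k * v) ≡ k * (x * u * v)
  lemma = solve-∀

⋆-scaleˡ : ∀ n a b k → ((λ i → k * a i) ⋆ b) n ≡ k * (a ⋆ b) n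
⋆-scaleˡ n a b k = trans (⋆-comm n _ b) (trans (⋆-scaleʳ n b a k) (cong (k *_) (⋆-comm n b a)))

⋆-assoc : ∀ n a b c → ((a ⋆ b) ⋆ c) n ≡ (a ⋆ (b ⋆ c)) n
⋆-assoc zero a b c
  rewrite ⋆-zero (a ⋆ b) c | ⋆-zero a (b ⋆ c) | ⋆-zero a b | ⋆-zero b c = ℤₚ.*-assoc (a 0) (b 0) (c 0)
⋆-assoc (suc n) a b c = begin
  ((a ⋆ b) ⋆ c) (suc n)
    ≡⟨ ⋆-leibniz (a ⋆ b) c n ⟩
  (∂ (a ⋆ b) ⋆ c) n + ((a ⋆ b) ⋆ ∂ c) n
    ≡⟨ cong (_+ ((a ⋆ b) ⋆ ∂ c) n) (trans (⋆-cong {b = c} (⋆-leibniz a b) (λ _ → refl) n)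
                                          (⋆-distribʳ-+ n (∂ a ⋆ b) (a ⋆ ∂ b) c)) ⟩
  ((∂ a ⋆ b) ⋆ c) n + ((a ⋆ ∂ b) ⋆ c) n + ((a ⋆ b) ⋆ ∂ c) n
    ≡⟨ cong₂ _+_ (cong₂ _+_ (⋆-assoc n (∂ a) b c) (⋆-assoc n a (∂ b) c)) (⋆-assoc n a b (∂ c)) ⟩
  (∂ a ⋆ (b ⋆ c)) n + (a ⋆ (∂ b ⋆ c)) n + (a ⋆ (b ⋆ ∂ c)) n
    ≡⟨ ℤₚ.+-assoc ((∂ a ⋆ (b ⋆ c)) n) _ _ ⟩
  (∂ a ⋆ (b ⋆ c)) n + ((a ⋆ (∂ b ⋆ c)) n + (a ⋆ (b ⋆ ∂ c)) n)
    ≡⟨ cong (_+_ ((∂ a ⋆ (b ⋆ c)) n)) (trans (⋆-cong {a = a} (λ _ → refl) (⋆-leibniz b c) n)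
                                          (⋆-distribˡ-+ n a (∂ b ⋆ c) (b ⋆ ∂ c))) ⟨
  (∂ a ⋆ (b ⋆ c)) n + (a ⋆ ∂ (b ⋆ c)) n
    ≡⟨ ⋆-leibniz a (b ⋆ c) n ⟨
  (a ⋆ (b ⋆ c)) (suc n)
    ∎
  where open ≡-Reasoning

⋆-identityˡ : ∀ n a → (δ ⋆ a) n ≡ a n
⋆-identityˡ n a = begin
  (δ ⋆ a) n                                        ≡⟨ sum-suc n _ ⟩
  + 1 * + 1 * a n + sumTo n (λ i → + (n C suc i) * + 0 * a (n ∸ suc i))
    ≡⟨ cong (_+_ (+ 1 * + 1 * a n)) (sum-zero n _ (λ i _ → lemma (+ (n C suc i)) (a (n ∸ suc i)))) ⟩
  + 1 * + 1 * a n + + 0                            ≡⟨ lemma′ (a n) ⟩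
  a n                                              ∎
  where
  open ≡-Reasoning
  lemma : ∀ c x → c * + 0 * x ≡ + 0
  lemma = solve-∀
  lemma′ : ∀ x → + 1 * + 1 * x + + 0 ≡ x
  lemma′ = solve-∀

binomial : ∀ n x y → (powers x ⋆ powers y) n ≡ (x + y) ^ n
binomial zero    x y = ⋆-zero (powers x) (powers y)
binomial (suc n) x y = begin
  (powers x ⋆ powers y) (suc n)
    ≡⟨ ⋆-leibniz (powers x) (powers y) n ⟩
  ((λ i → x * x ^ i) ⋆ powers y) n + (powers x ⋆ (λ i → y * y ^ i)) n
    ≡⟨ cong₂ _+_ (⋆-scaleˡ n (powers x) (powers y) x) (⋆-scaleʳ n (powers x) (powers y) y) ⟩
  x * (powers x ⋆ powers y) n + y * (powers x ⋆ powers y) n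
    ≡⟨ ℤₚ.*-distribʳ-+ ((powers x ⋆ powers y) n) x y ⟨
  (x + y) * (powers x ⋆ powers y) n
    ≡⟨ cong ((x + y) *_) (binomial n x y) ⟩
  (x + y) ^ suc n
    ∎
  where open ≡-Reasoning

true-if-T : ∀ {b} → T b → b ≡ true
true-if-T = Equivalence.to T-≡

false-if-¬T : ∀ {b} → ¬ T b → b ≡ false
false-if-¬T {false} _  = refl
false-if-¬T {true}  ¬b = ⊥-elim (¬b _)

≤ᵇ-true : ∀ {m n} → m ≤ n → (m ≤ᵇ n) ≡ true
≤ᵇ-true m≤n = true-if-T (ℕₚ.≤⇒≤ᵇ m≤n)

≤ᵇ-false : ∀ {m n} → ¬ (m ≤ n) → (m ≤ᵇ n) ≡ false
≤ᵇ-false {m} {n} m≰n = false-if-¬T (λ m≤ᵇn → m≰n (ℕₚ.≤ᵇ⇒≤ m n m≤ᵇn))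

<ᵇ-true : ∀ {m n} → m < n → (m <ᵇ n) ≡ true
<ᵇ-true m<n = true-if-T (ℕₚ.<⇒<ᵇ m<n)

<ᵇ-false : ∀ {m n} → ¬ (m < n) → (m <ᵇ n) ≡ false
<ᵇ-false {m} {n} m≮n = false-if-¬T (λ m<ᵇn → m≮n (ℕₚ.<ᵇ⇒< m n m<ᵇn))

-1^-square : ∀ u → -1ℤ ^ u * -1ℤ ^ u ≡ + 1
-1^-square zero    = refl
-1^-square (suc u) = trans (lemma (-1ℤ ^ u)) (-1^-square u)
  where
  lemma : ∀ x → -1ℤ * x * (-1ℤ * x) ≡ x * x
  lemma = solve-∀

-1^-even : ∀ c → -1ℤ ^ (2 ℕ.* c) ≡ + 1
-1^-even c = trans (sym (ℤₚ.^-*-assoc -1ℤ 2 c)) (ℤₚ.^-zeroˡ c)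

-1^-∸ : ∀ {m n} → n ≤ m → -1ℤ ^ (m ∸ n) ≡ -1ℤ ^ m * -1ℤ ^ n
-1^-∸ {m} {n} n≤m = begin
  -1ℤ ^ (m ∸ n)                              ≡⟨ ℤₚ.*-identityʳ _ ⟨
  -1ℤ ^ (m ∸ n) * + 1                        ≡⟨ cong (-1ℤ ^ (m ∸ n) *_) (-1^-square n) ⟨
  -1ℤ ^ (m ∸ n) * (-1ℤ ^ n * -1ℤ ^ n)        ≡⟨ ℤₚ.*-assoc (-1ℤ ^ (m ∸ n)) _ _ ⟨
  -1ℤ ^ (m ∸ n) * -1ℤ ^ n * -1ℤ ^ n          ≡⟨ cong (_* -1ℤ ^ n) (ℤₚ.^-distribˡ-+-* -1ℤ (m ∸ n) n) ⟨
  -1ℤ ^ (m ∸ n ℕ.+ n) * -1ℤ ^ n              ≡⟨ cong (λ k → -1ℤ ^ k * -1ℤ ^ n) (ℕₚ.m∸n+n≡m n≤m) ⟩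
  -1ℤ ^ m * -1ℤ ^ n                          ∎
  where open ≡-Reasoning

data Parity : ℕ → Set where
  even : ∀ u → Parity (2 ℕ.* u)
  odd  : ∀ u → Parity (suc (2 ℕ.* u))

parity : ∀ n → Parity n
parity zero = even 0
parity (suc n) with parity n
... | even u = odd u
... | odd u  = subst Parity (ℕₚ.*-suc 2 u) (even (suc u))

eulerUpTo-stable : ∀ n i → i ≤ n → eulerUpTo n i ≡ E i
eulerUpTo-stable zero    zero z≤n = refl
eulerUpTo-stable (suc n) i i≤1+n with i ℕ.≟ suc n
... | yes refl   = refl
... | no  i≢1+n = below (ℕₚ.≤-pred (ℕₚ.≤∧≢⇒< i≤1+n i≢1+n))
  where
  below : i ≤ n → eulerUpTo (suc n) i ≡ E i
  below i≤n rewrite ≤ᵇ-true i≤n = eulerUpTo-stable n i i≤n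

eulerTerm : ℕ → ℕ → ℤ
eulerTerm n k = if (1 ≤ᵇ k) ∧ (2 ℕ.* k ≤ᵇ n)
                then (- (-1ℤ ^ k)) * (+ (n C (2 ℕ.* k))) * E (n ∸ 2 ℕ.* k)
                else + 0

E-recurrence : ∀ m → E (suc m) ≡ sumTo (suc (suc m)) (eulerTerm (suc m))
E-recurrence m rewrite ≤ᵇ-false (ℕₚ.n≮n m) = sum-cong (suc (suc m)) stable
  where
  stable : ∀ k → k < suc (suc m) → _ ≡ eulerTerm (suc m) k
  stable zero    _ = refl
  stable (suc k) _ =
    cong (λ e → if (2 ℕ.* suc k ≤ᵇ suc m) then (- (-1ℤ ^ suc k)) * (+ (suc m C (2 ℕ.* suc k))) * e else + 0)
         (eulerUpTo-stable m (suc m ∸ 2 ℕ.* suc k) (ℕₚ.m∸n≤m m (k ℕ.+ 1 ℕ.* suc k)))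

eulerTerm-in : ∀ n k → 2 ℕ.* suc k ≤ n →
  eulerTerm n (suc k) ≡ (- (-1ℤ ^ suc k)) * + (n C (2 ℕ.* suc k)) * E (n ∸ 2 ℕ.* suc k)
eulerTerm-in n k 2k≤n rewrite ≤ᵇ-true 2k≤n = refl

eulerTerm-out : ∀ n k → ¬ (2 ℕ.* suc k ≤ n) → eulerTerm n (suc k) ≡ + 0
eulerTerm-out n k 2k≰n rewrite ≤ᵇ-false 2k≰n = refl

eulerTerm-odd : ∀ j k → (∀ {i} → i < j → E (suc (2 ℕ.* i)) ≡ + 0) → eulerTerm (suc (2 ℕ.* j)) k ≡ + 0
eulerTerm-odd j zero    _   = refl
eulerTerm-odd j (suc k) E≡0 with 2 ℕ.* suc k ℕ.≤? suc (2 ℕ.* j)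
... | no  2k≰n = eulerTerm-out _ k 2k≰n
... | yes 2k≤n = begin
  eulerTerm (suc (2 ℕ.* j)) (suc k)                ≡⟨ eulerTerm-in _ k 2k≤n ⟩
  coefficient * E (suc (2 ℕ.* j) ∸ 2 ℕ.* suc k)   ≡⟨ cong (coefficient *_) smaller ⟩
  coefficient * + 0                               ≡⟨ ℤₚ.*-zeroʳ coefficient ⟩
  + 0                                             ∎
  where
  open ≡-Reasoning
  coefficient : ℤ
  coefficient = (- (-1ℤ ^ suc k)) * + (suc (2 ℕ.* j) C (2 ℕ.* suc k))
  k<j : suc k ≤ j
  k<j = ℕₚ.*-cancelˡ-< 2 k j (ℕₚ.≤-pred (subst (_≤ suc (2 ℕ.* j)) (ℕₚ.*-suc 2 k) 2k≤n))
  smaller : E (suc (2 ℕ.* j) ∸ 2 ℕ.* suc k) ≡ + 0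
  smaller = trans (cong E (trans (ℕₚ.+-∸-assoc 1 (ℕₚ.*-monoʳ-≤ 2 k<j)) (cong suc (sym (ℕₚ.*-distribˡ-∸ 2 j (suc k))))))
                  (E≡0 (ℕₚ.∸-monoʳ-< {j} {suc k} {0} (s≤s z≤n) k<j))

E-odd : ∀ j → E (suc (2 ℕ.* j)) ≡ + 0
E-odd = <-rec (λ j → E (suc (2 ℕ.* j)) ≡ + 0) (λ j E≡0 → trans (E-recurrence (2 ℕ.* j)) (sum-zero (suc (suc (2 ℕ.* j))) _ (λ k _ → eulerTerm-odd j k E≡0)))

halfSign : ℕ → ℤ
halfSign zero          = + 1
halfSign (suc zero)    = + 1
halfSign (suc (suc n)) = - halfSign n

cosh : Seq
cosh zero          = + 1
cosh (suc zero)    = + 0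
cosh (suc (suc n)) = cosh n

-- sech z = sec (i z), so its coefficients are the Euler numbers up to the sign (-1)^⌊n/2⌋.
sech : Seq
sech n = halfSign n * E n

halfSign-even : ∀ c → halfSign (2 ℕ.* c) ≡ -1ℤ ^ c
halfSign-even zero    = refl
halfSign-even (suc c) = trans (cong halfSign (ℕₚ.*-suc 2 c)) (trans (cong -_ (halfSign-even c)) (lemma (-1ℤ ^ c)))
  where
  lemma : ∀ x → - x ≡ -1ℤ * x
  lemma = solve-∀

halfSign-+ : ∀ u r → halfSign (2 ℕ.* u ℕ.+ r) ≡ -1ℤ ^ u * halfSign r
halfSign-+ zero    r = sym (ℤₚ.*-identityˡ (halfSign r))
halfSign-+ (suc u) r = begin
  halfSign (2 ℕ.* suc u ℕ.+ r)      ≡⟨ cong (λ k → halfSign (k ℕ.+ r)) (ℕₚ.*-suc 2 u) ⟩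
  - halfSign (2 ℕ.* u ℕ.+ r)        ≡⟨ cong -_ (halfSign-+ u r) ⟩
  - (-1ℤ ^ u * halfSign r)          ≡⟨ lemma (-1ℤ ^ u) (halfSign r) ⟩
  -1ℤ ^ suc u * halfSign r          ∎
  where
  open ≡-Reasoning
  lemma : ∀ x y → - (x * y) ≡ -1ℤ * x * y
  lemma = solve-∀

halfSign-∸ : ∀ u n → 2 ℕ.* u ≤ n → halfSign (n ∸ 2 ℕ.* u) ≡ -1ℤ ^ u * halfSign n
halfSign-∸ u n 2u≤n = begin
  halfSign (n ∸ 2 ℕ.* u)                            ≡⟨ ℤₚ.*-identityˡ _ ⟨
  + 1 * halfSign (n ∸ 2 ℕ.* u)                      ≡⟨ cong (_* halfSign (n ∸ 2 ℕ.* u)) (-1^-square u) ⟨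
  -1ℤ ^ u * -1ℤ ^ u * halfSign (n ∸ 2 ℕ.* u)        ≡⟨ ℤₚ.*-assoc (-1ℤ ^ u) _ _ ⟩
  -1ℤ ^ u * (-1ℤ ^ u * halfSign (n ∸ 2 ℕ.* u))      ≡⟨ cong (-1ℤ ^ u *_) (halfSign-+ u (n ∸ 2 ℕ.* u)) ⟨
  -1ℤ ^ u * halfSign (2 ℕ.* u ℕ.+ (n ∸ 2 ℕ.* u))    ≡⟨ cong (λ k → -1ℤ ^ u * halfSign k) (ℕₚ.m+[n∸m]≡n 2u≤n) ⟩
  -1ℤ ^ u * halfSign n                              ∎
  where open ≡-Reasoning

cosh-even : ∀ u → cosh (2 ℕ.* u) ≡ + 1
cosh-even zero    = refl
cosh-even (suc u) = trans (cong cosh (ℕₚ.*-suc 2 u)) (cosh-even u)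

cosh-odd : ∀ u → cosh (suc (2 ℕ.* u)) ≡ + 0
cosh-odd zero    = refl
cosh-odd (suc u) = trans (cong (λ k → cosh (suc k)) (ℕₚ.*-suc 2 u)) (cosh-odd u)

⋆-cosh : ∀ n a → (cosh ⋆ a) n ≡ sumTo (suc n) (λ u → + (n C (2 ℕ.* u)) * a (n ∸ 2 ℕ.* u))
⋆-cosh n a = begin
  (cosh ⋆ a) n
    ≡⟨ sum-vanishing-tail term (ℕₚ.m≤n*m (suc n) 2) (λ i n<i → cong (λ c → + c * cosh i * a (n ∸ i)) (ℕC.k>n⇒nCk≡0 n<i)) ⟨
  sumTo (2 ℕ.* suc n) term
    ≡⟨ sum-evenOdd (suc n) term ⟩
  sumTo (suc n) (λ u → term (2 ℕ.* u)) + sumTo (suc n) (λ u → term (suc (2 ℕ.* u)))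
    ≡⟨ cong₂ _+_ (sum-cong (suc n) (λ u _ → evenTerm u)) (sum-zero (suc n) _ (λ u _ → oddTerm u)) ⟩
  sumTo (suc n) (λ u → + (n C (2 ℕ.* u)) * a (n ∸ 2 ℕ.* u)) + + 0
    ≡⟨ ℤₚ.+-identityʳ _ ⟩
  sumTo (suc n) (λ u → + (n C (2 ℕ.* u)) * a (n ∸ 2 ℕ.* u))
    ∎
  where
  open ≡-Reasoning
  term : ℕ → ℤ
  term i = + (n C i) * cosh i * a (n ∸ i)
  evenTerm : ∀ u → term (2 ℕ.* u) ≡ + (n C (2 ℕ.* u)) * a (n ∸ 2 ℕ.* u)
  evenTerm u rewrite cosh-even u = cong (_* a (n ∸ 2 ℕ.* u)) (ℤₚ.*-identityʳ (+ (n C (2 ℕ.* u))))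
  oddTerm : ∀ u → term (suc (2 ℕ.* u)) ≡ + 0
  oddTerm u rewrite cosh-odd u | ℤₚ.*-zeroʳ (+ (n C suc (2 ℕ.* u))) = ℤₚ.*-zeroˡ (a (n ∸ suc (2 ℕ.* u)))

cosh⋆sech-term : ∀ n u → + (n C (2 ℕ.* u)) * sech (n ∸ 2 ℕ.* u) ≡ halfSign n * (δ u * E n) - halfSign n * eulerTerm n u
cosh⋆sech-term n zero    = lemma (halfSign n) (E n)
  where
  lemma : ∀ s e → + 1 * (s * e) ≡ s * (+ 1 * e) - s * + 0
  lemma = solve-∀
cosh⋆sech-term n (suc v) with 2 ℕ.* suc v ℕ.≤? n
... | yes 2u≤n = begin
  + c * (halfSign (n ∸ 2 ℕ.* suc v) * e)           ≡⟨ cong (λ s → + c * (s * e)) (halfSign-∸ (suc v) n 2u≤n) ⟩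
  + c * (-1ℤ ^ suc v * halfSign n * e)            ≡⟨ lemma (+ c) (-1ℤ ^ suc v) (halfSign n) e (E n) ⟩
  halfSign n * (+ 0 * E n) - halfSign n * ((- (-1ℤ ^ suc v)) * + c * e)
    ≡⟨ cong (λ x → halfSign n * (+ 0 * E n) - halfSign n * x) (eulerTerm-in n v 2u≤n) ⟨
  halfSign n * (+ 0 * E n) - halfSign n * eulerTerm n (suc v) ∎
  where
  open ≡-Reasoning
  c = n C (2 ℕ.* suc v)
  e = E (n ∸ 2 ℕ.* suc v)
  lemma : ∀ c σ s e f → c * (σ * s * e) ≡ s * (+ 0 * f) - s * ((- σ) * c * e)
  lemma = solve-∀
... | no 2u≰n = begin
  + (n C (2 ℕ.* suc v)) * sech (n ∸ 2 ℕ.* suc v)   ≡⟨ cong (λ c → + c * sech (n ∸ 2 ℕ.* suc v)) (ℕC.k>n⇒nCk≡0 (ℕₚ.≰⇒> 2u≰n)) ⟩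
  + 0 * sech (n ∸ 2 ℕ.* suc v)                     ≡⟨ lemma (sech (n ∸ 2 ℕ.* suc v)) (halfSign n) (E n) ⟩
  halfSign n * (+ 0 * E n) - halfSign n * + 0      ≡⟨ cong (λ x → halfSign n * (+ 0 * E n) - halfSign n * x) (eulerTerm-out n v 2u≰n) ⟨
  halfSign n * (+ 0 * E n) - halfSign n * eulerTerm n (suc v) ∎
  where
  open ≡-Reasoning
  lemma : ∀ x s f → + 0 * x ≡ s * (+ 0 * f) - s * + 0
  lemma = solve-∀

-- The coefficientwise form of cosh z · sech z = 1; this is where the recurrence defining E enters.
cosh⋆sech : ∀ n → (cosh ⋆ sech) n ≡ δ n
cosh⋆sech zero    = refl
cosh⋆sech (suc m) = begin
  (cosh ⋆ sech) n
    ≡⟨ ⋆-cosh n sech ⟩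
  sumTo (suc n) (λ u → + (n C (2 ℕ.* u)) * sech (n ∸ 2 ℕ.* u))
    ≡⟨ sum-cong (suc n) (λ u _ → cosh⋆sech-term n u) ⟩
  sumTo (suc n) (λ u → halfSign n * (δ u * E n) - halfSign n * eulerTerm n u)
    ≡⟨ sum-- (suc n) _ _ ⟩
  sumTo (suc n) (λ u → halfSign n * (δ u * E n)) - sumTo (suc n) (λ u → halfSign n * eulerTerm n u)
    ≡⟨ cong₂ _-_ (sum-*ˡ (suc n) (halfSign n) _) (sum-*ˡ (suc n) (halfSign n) _) ⟩
  halfSign n * sumTo (suc n) (λ u → δ u * E n) - halfSign n * sumTo (suc n) (eulerTerm n)
    ≡⟨ cong₂ (λ x y → halfSign n * x - halfSign n * y) leadingTerm (sym (E-recurrence m)) ⟩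
  halfSign n * E n - halfSign n * E n
    ≡⟨ ℤₚ.+-inverseʳ (halfSign n * E n) ⟩
  + 0
    ∎
  where
  open ≡-Reasoning
  n = suc m
  leadingTerm : sumTo (suc n) (λ u → δ u * E n) ≡ E n
  leadingTerm = trans (sum-suc n _) (trans (cong (_+_ (+ 1 * E n)) (sum-zero n _ (λ _ _ → refl)))
                                           (trans (ℤₚ.+-identityʳ _) (ℤₚ.*-identityˡ (E n))))

sech-odd : ∀ u → sech (suc (2 ℕ.* u)) ≡ + 0
sech-odd u = trans (cong (halfSign (suc (2 ℕ.* u)) *_) (E-odd u)) (ℤₚ.*-zeroʳ (halfSign (suc (2 ℕ.* u))))

-- The coefficients of e^{xz} sech z; in terms of the Euler polynomials this is 2^n E_n((x+1)/2).
eulerPoly : ℕ → ℤ → ℤ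
eulerPoly n x = (sech ⋆ powers x) n

exponentials-cosh : ∀ i → -1ℤ ^ i + (+ 1) ^ i ≡ + 2 * cosh i
exponentials-cosh zero          = refl
exponentials-cosh (suc zero)    = refl
exponentials-cosh (suc (suc i)) = trans (lemma (-1ℤ ^ i) ((+ 1) ^ i)) (exponentials-cosh i)
  where
  lemma : ∀ a b → -1ℤ * (-1ℤ * a) + + 1 * (+ 1 * b) ≡ a + b
  lemma = solve-∀

eulerPoly-reflection : ∀ n y → eulerPoly n (y - + 1) + eulerPoly n (y + + 1) ≡ + 2 * y ^ n
eulerPoly-reflection n y = begin
  eulerPoly n (y - + 1) + eulerPoly n (y + + 1)
    ≡⟨ cong₂ _+_ (shifted -1ℤ (y - + 1) (lemma₁ y)) (shifted (+ 1) (y + + 1) (lemma₂ y)) ⟩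
  (sech ⋆ (powers -1ℤ ⋆ powers y)) n + (sech ⋆ (powers (+ 1) ⋆ powers y)) n
    ≡⟨ ⋆-distribˡ-+ n sech (powers -1ℤ ⋆ powers y) (powers (+ 1) ⋆ powers y) ⟨
  (sech ⋆ (λ i → (powers -1ℤ ⋆ powers y) i + (powers (+ 1) ⋆ powers y) i)) n
    ≡⟨ ⋆-cong {a = sech} (λ _ → refl) twoCosh n ⟩
  (sech ⋆ (λ i → + 2 * (cosh ⋆ powers y) i)) n
    ≡⟨ ⋆-scaleʳ n sech (cosh ⋆ powers y) (+ 2) ⟩
  + 2 * (sech ⋆ (cosh ⋆ powers y)) n
    ≡⟨ cong (+ 2 *_) (⋆-assoc n sech cosh (powers y)) ⟨
  + 2 * ((sech ⋆ cosh) ⋆ powers y) n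
    ≡⟨ cong (+ 2 *_) (⋆-cong {b = powers y} (λ i → trans (⋆-comm i sech cosh) (cosh⋆sech i)) (λ _ → refl) n) ⟩
  + 2 * (δ ⋆ powers y) n
    ≡⟨ cong (+ 2 *_) (⋆-identityˡ n (powers y)) ⟩
  + 2 * y ^ n
    ∎
  where
  open ≡-Reasoning
  lemma₁ : ∀ y → -1ℤ + y ≡ y - + 1
  lemma₁ = solve-∀
  lemma₂ : ∀ y → + 1 + y ≡ y + + 1
  lemma₂ = solve-∀
  shifted : ∀ c x → c + y ≡ x → eulerPoly n x ≡ (sech ⋆ (powers c ⋆ powers y)) n
  shifted c x c+y≡x = ⋆-cong {a = sech} (λ _ → refl) (λ i → trans (cong (_^ i) (sym c+y≡x)) (sym (binomial i c y))) n
  twoCosh : ∀ i → (powers -1ℤ ⋆ powers y) i + (powers (+ 1) ⋆ powers y) i ≡ + 2 * (cosh ⋆ powers y) i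
  twoCosh i = trans (sym (⋆-distribʳ-+ i (powers -1ℤ) (powers (+ 1)) (powers y)))
                    (trans (⋆-cong {b = powers y} exponentials-cosh (λ _ → refl) i) (⋆-scaleˡ i cosh (powers y) (+ 2)))

eulerPoly-at-0 : ∀ n → eulerPoly n (+ 0) ≡ sech n
eulerPoly-at-0 n = trans (⋆-cong {a = sech} (λ _ → refl) zero-powers n) (trans (⋆-comm n sech δ) (⋆-identityˡ n sech))
  where
  zero-powers : ∀ i → (+ 0) ^ i ≡ δ i
  zero-powers zero    = refl
  zero-powers (suc i) = refl

eulerPoly-even-symmetry : ∀ j → eulerPoly (2 ℕ.* j) -1ℤ ≡ eulerPoly (2 ℕ.* j) (+ 1)
eulerPoly-even-symmetry j = sum-cong (suc (2 ℕ.* j)) (λ i _ → termwise i (parity i))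
  where
  termwise : ∀ i → Parity i → + (2 ℕ.* j C i) * sech i * -1ℤ ^ (2 ℕ.* j ∸ i) ≡ + (2 ℕ.* j C i) * sech i * (+ 1) ^ (2 ℕ.* j ∸ i)
  termwise .(2 ℕ.* a) (even a) = cong (+ (2 ℕ.* j C (2 ℕ.* a)) * sech (2 ℕ.* a) *_)
    (trans (cong (-1ℤ ^_) (sym (ℕₚ.*-distribˡ-∸ 2 j a)))
           (trans (-1^-even (j ∸ a)) (sym (ℤₚ.^-zeroˡ (2 ℕ.* j ∸ 2 ℕ.* a)))))
  termwise .(suc (2 ℕ.* a)) (odd a) rewrite sech-odd a | ℤₚ.*-zeroʳ (+ (2 ℕ.* j C suc (2 ℕ.* a))) =
    trans (ℤₚ.*-zeroˡ (-1ℤ ^ (2 ℕ.* j ∸ suc (2 ℕ.* a)))) (sym (ℤₚ.*-zeroˡ ((+ 1) ^ (2 ℕ.* j ∸ suc (2 ℕ.* a)))))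

eulerPoly-at-−1 : ∀ j → eulerPoly (2 ℕ.* suc j) -1ℤ ≡ + 0
eulerPoly-at-−1 j = double≡0 (begin
  eulerPoly t -1ℤ + eulerPoly t -1ℤ       ≡⟨ cong (_+_ (eulerPoly t -1ℤ)) (eulerPoly-even-symmetry (suc j)) ⟩
  eulerPoly t -1ℤ + eulerPoly t (+ 1)     ≡⟨ eulerPoly-reflection t (+ 0) ⟩
  + 2 * (+ 0) ^ t                           ≡⟨⟩
  + 0                                     ∎)
  where
  open ≡-Reasoning
  t = 2 ℕ.* suc j
  double≡0 : ∀ {x} → x + x ≡ + 0 → x ≡ + 0
  double≡0 {+ zero}    _  = refl
  double≡0 {+ suc n}   ()
  double≡0 {ℤ.-[1+ n ]} ()

alternatingOddPowers : ℕ → ℕ → ℤ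
alternatingOddPowers t M = sumTo M (λ i → -1ℤ ^ i * (+ suc (2 ℕ.* i)) ^ t)

alternatingOddPowers-telescope : ∀ t M →
  + 2 * alternatingOddPowers t M ≡ eulerPoly t (+ 0) - -1ℤ ^ M * eulerPoly t (+ (2 ℕ.* M))
alternatingOddPowers-telescope t zero = sym (lemma (eulerPoly t (+ 0)))
  where
  lemma : ∀ a → a - + 1 * a ≡ + 0
  lemma = solve-∀
alternatingOddPowers-telescope t (suc M) = begin
  + 2 * (alternatingOddPowers t M + σ * o ^ t)
    ≡⟨ ℤₚ.*-distribˡ-+ (+ 2) (alternatingOddPowers t M) (σ * o ^ t) ⟩
  + 2 * alternatingOddPowers t M + + 2 * (σ * o ^ t)
    ≡⟨ cong₂ _+_ (alternatingOddPowers-telescope t M) (lemma₁ σ (o ^ t)) ⟩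
  Q₀ - σ * eulerPoly t (+ (2 ℕ.* M)) + σ * (+ 2 * o ^ t)
    ≡⟨ cong (λ x → Q₀ - σ * eulerPoly t (+ (2 ℕ.* M)) + σ * x) reflection ⟨
  Q₀ - σ * eulerPoly t (+ (2 ℕ.* M)) + σ * (eulerPoly t (+ (2 ℕ.* M)) + eulerPoly t (+ (2 ℕ.* suc M)))
    ≡⟨ lemma₂ Q₀ σ (eulerPoly t (+ (2 ℕ.* M))) (eulerPoly t (+ (2 ℕ.* suc M))) ⟩
  Q₀ - -1ℤ ^ suc M * eulerPoly t (+ (2 ℕ.* suc M))
    ∎
  where
  open ≡-Reasoning
  σ = -1ℤ ^ M
  o = + suc (2 ℕ.* M)
  Q₀ = eulerPoly t (+ 0)
  lemma₁ : ∀ s x → + 2 * (s * x) ≡ s * (+ 2 * x)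
  lemma₁ = solve-∀
  lemma₂ : ∀ a s b c → a - s * b + s * (b + c) ≡ a - -1ℤ * s * c
  lemma₂ = solve-∀
  below : o - + 1 ≡ + (2 ℕ.* M)
  below = trans (cong (_- + 1) (ℤₚ.pos-+ 1 (2 ℕ.* M))) (lemma (+ (2 ℕ.* M)))
    where
    lemma : ∀ y → + 1 + y - + 1 ≡ y
    lemma = solve-∀
  above : o + + 1 ≡ + (2 ℕ.* suc M)
  above = trans (sym (ℤₚ.pos-+ (suc (2 ℕ.* M)) 1))
                (cong +_ (trans (ℕₚ.+-comm (suc (2 ℕ.* M)) 1) (sym (ℕₚ.*-suc 2 M))))
  reflection : eulerPoly t (+ (2 ℕ.* M)) + eulerPoly t (+ (2 ℕ.* suc M)) ≡ + 2 * o ^ t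
  reflection = subst₂ (λ x y → eulerPoly t x + eulerPoly t y ≡ + 2 * o ^ t) below above (eulerPoly-reflection t o)

module _ (m : ℕ) where
  open Modulo (+ suc (2 ℕ.* m))

  eulerPoly-cong : ∀ n {x y} → x ≈ y → eulerPoly n x ≈ eulerPoly n y
  eulerPoly-cong n x≈y = sum-cong≈ (suc n) (λ i _ → *-congˡ (+ (n C i) * sech i) (^-congˡ (n ∸ i) x≈y))

  -- Modulo 2m+1 the telescoping sum stops at 2m ≡ -1, where the Euler polynomial vanishes.
  alternatingOddPowers≈sech : ∀ j → + 2 * alternatingOddPowers (2 ℕ.* suc j) m ≈ sech (2 ℕ.* suc j)
  alternatingOddPowers≈sech j = begin
    + 2 * alternatingOddPowers t m                                 ≡⟨ alternatingOddPowers-telescope t m ⟩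
    eulerPoly t (+ 0) - -1ℤ ^ m * eulerPoly t (+ (2 ℕ.* m))
      ≈⟨ -‿cong₂ (≡⇒≈ (eulerPoly-at-0 t)) (*-congˡ (-1ℤ ^ m) (eulerPoly-cong t 2m≈-1)) ⟩
    sech t - -1ℤ ^ m * eulerPoly t -1ℤ                             ≡⟨ cong (λ x → sech t - -1ℤ ^ m * x) (eulerPoly-at-−1 j) ⟩
    sech t - -1ℤ ^ m * + 0                                         ≡⟨ lemma (sech t) (-1ℤ ^ m) ⟩
    sech t                                                         ∎
    where
    open ≈-Reasoning
    t = 2 ℕ.* suc j
    2m≈-1 : + (2 ℕ.* m) ≈ -1ℤ
    2m≈-1 = + 1 , lemma′ (+ (2 ℕ.* m))
      where
      lemma′ : ∀ y → y ≡ -1ℤ + + 1 * (+ 1 + y)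
      lemma′ = solve-∀
    lemma : ∀ a b → a - b * + 0 ≡ a
    lemma = solve-∀

[k+1]*[n+1]C[k+1]≡[n+1]*nCk : ∀ n k → suc k ℕ.* (suc n C suc k) ≡ suc n ℕ.* (n C k)
[k+1]*[n+1]C[k+1]≡[n+1]*nCk n zero rewrite ℕC.nC1≡n (suc n) =
  cong suc (trans (ℕₚ.+-identityʳ n) (sym (ℕₚ.*-identityʳ n)))
[k+1]*[n+1]C[k+1]≡[n+1]*nCk zero (suc k)
  rewrite ℕC.k>n⇒nCk≡0 {1} {suc (suc k)} (s≤s (s≤s z≤n)) | ℕC.k>n⇒nCk≡0 {0} {suc k} (s≤s z≤n) = ℕₚ.*-zeroʳ (suc (suc k))
[k+1]*[n+1]C[k+1]≡[n+1]*nCk (suc n) (suc k) = begin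
  suc (suc k) ℕ.* (suc (suc n) C suc (suc k))
    ≡⟨ cong (suc (suc k) ℕ.*_) (ℕC.nCk+nC[k+1]≡[n+1]C[k+1] (suc n) (suc k)) ⟨
  suc (suc k) ℕ.* (suc n C suc k ℕ.+ suc n C suc (suc k))
    ≡⟨ ℕₚ.*-distribˡ-+ (suc (suc k)) (suc n C suc k) (suc n C suc (suc k)) ⟩
  suc (suc k) ℕ.* (suc n C suc k) ℕ.+ suc (suc k) ℕ.* (suc n C suc (suc k))
    ≡⟨ ℕₚ.+-assoc (suc n C suc k) (suc k ℕ.* (suc n C suc k)) (suc (suc k) ℕ.* (suc n C suc (suc k))) ⟩
  suc n C suc k ℕ.+ (suc k ℕ.* (suc n C suc k) ℕ.+ suc (suc k) ℕ.* (suc n C suc (suc k)))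
    ≡⟨ cong (suc n C suc k ℕ.+_) (cong₂ ℕ._+_ ([k+1]*[n+1]C[k+1]≡[n+1]*nCk n k) ([k+1]*[n+1]C[k+1]≡[n+1]*nCk n (suc k))) ⟩
  suc n C suc k ℕ.+ (suc n ℕ.* (n C k) ℕ.+ suc n ℕ.* (n C suc k))
    ≡⟨ cong (suc n C suc k ℕ.+_) (ℕₚ.*-distribˡ-+ (suc n) (n C k) (n C suc k)) ⟨
  suc n C suc k ℕ.+ suc n ℕ.* (n C k ℕ.+ n C suc k)
    ≡⟨ cong (λ c → suc n C suc k ℕ.+ suc n ℕ.* c) (ℕC.nCk+nC[k+1]≡[n+1]C[k+1] n k) ⟩
  suc (suc n) ℕ.* (suc n C suc k)
    ∎
  where open ≡-Reasoning

powerSum : ℕ → ℕ → ℤ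
powerSum n j = sumTo n (λ s → (+ s) ^ j)

succ-power-difference : ∀ (x : ℤ) j → (x + + 1) ^ suc j - x ^ suc j ≡ sumTo (suc j) (λ i → + (suc j C i) * x ^ i)
succ-power-difference x j = begin
  (x + + 1) ^ suc j - x ^ suc j
    ≡⟨ cong (_- x ^ suc j) (binomial (suc j) x (+ 1)) ⟨
  sumTo (suc j) (λ i → + (suc j C i) * x ^ i * (+ 1) ^ (suc j ∸ i)) + + (suc j C suc j) * x ^ suc j * (+ 1) ^ (j ∸ j) - x ^ suc j
    ≡⟨ cong (λ c → sumTo (suc j) (λ i → + (suc j C i) * x ^ i * (+ 1) ^ (suc j ∸ i)) + + (suc j C suc j) * x ^ suc j * c - x ^ suc j)
            (ℤₚ.^-zeroˡ (j ∸ j)) ⟩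
  sumTo (suc j) (λ i → + (suc j C i) * x ^ i * (+ 1) ^ (suc j ∸ i)) + + (suc j C suc j) * x ^ suc j * + 1 - x ^ suc j
    ≡⟨ cong₂ (λ a c → a + + c * x ^ suc j * + 1 - x ^ suc j)
             (sum-cong (suc j) (λ i _ → trans (cong (+ (suc j C i) * x ^ i *_) (ℤₚ.^-zeroˡ (suc j ∸ i)))
                                              (ℤₚ.*-identityʳ _)))
             (ℕC.nCn≡1 (suc j)) ⟩
  sumTo (suc j) (λ i → + (suc j C i) * x ^ i) + + 1 * x ^ suc j * + 1 - x ^ suc j
    ≡⟨ lemma _ _ ⟩
  sumTo (suc j) (λ i → + (suc j C i) * x ^ i)
    ∎
  where
  open ≡-Reasoning
  lemma : ∀ a b → a + + 1 * b * + 1 - b ≡ a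
  lemma = solve-∀

powerSum-recurrence : ∀ n j → (+ n) ^ suc j ≡ sumTo (suc j) (λ i → + (suc j C i) * powerSum n i)
powerSum-recurrence n j = begin
  (+ n) ^ suc j
    ≡⟨ ℤₚ.+-identityʳ _ ⟨
  (+ n) ^ suc j - (+ 0) ^ suc j
    ≡⟨ sum-telescope n (λ s → (+ s) ^ suc j) ⟨
  sumTo n (λ s → (+ suc s) ^ suc j - (+ s) ^ suc j)
    ≡⟨ sum-cong n (λ s _ → trans (cong (λ z → z ^ suc j - (+ s) ^ suc j) (trans (cong +_ (ℕₚ.+-comm 1 s)) (ℤₚ.pos-+ s 1)))
                                 (succ-power-difference (+ s) j)) ⟩
  sumTo n (λ s → sumTo (suc j) (λ i → + (suc j C i) * (+ s) ^ i))
    ≡⟨ sum-swap n (suc j) (λ s i → + (suc j C i) * (+ s) ^ i) ⟩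
  sumTo (suc j) (λ i → sumTo n (λ s → + (suc j C i) * (+ s) ^ i))
    ≡⟨ sum-cong (suc j) (λ i _ → sum-*ˡ n (+ (suc j C i)) (λ s → (+ s) ^ i)) ⟩
  sumTo (suc j) (λ i → + (suc j C i) * powerSum n i)
    ∎
  where open ≡-Reasoning

module _ {n : ℕ} (p-prime : Prime (suc n)) where
  open Modulo (+ suc n)

  *≈0⇒≈0 : ∀ c x → 0 < c → c < suc n → + c * x ≈ + 0 → x ≈ + 0
  *≈0⇒≈0 (suc c) x _ c<p (q , cx≡qp)
    with euclidsLemma (suc c) ℤ.∣ x ∣ p-prime
           (subst (suc n ℕ∣.∣_) (ℤₚ.abs-* (+ suc c) x) (ℤ∣.∣⇒∣ᵤ (ℤ∣.divides q (trans cx≡qp (ℤₚ.+-identityˡ _)))))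
  ... | inj₁ p∣c = ⊥-elim (ℕ∣.>⇒∤ c<p p∣c)
  ... | inj₂ p∣x with ℤ∣.∣ᵤ⇒∣ {+ suc n} {x} p∣x
  ...   | ℤ∣.divides k x≡kp = k , trans x≡kp (sym (ℤₚ.+-identityˡ _))

  pC[i+1]≈0 : ∀ i → i < n → + (suc n C suc i) ≈ + 0
  pC[i+1]≈0 i i<n = *≈0⇒≈0 (suc i) (+ (suc n C suc i)) (s≤s z≤n) (s≤s i<n)
    (+ (n C i) , absorption)
    where
    open ≡-Reasoning
    absorption : + suc i * + (suc n C suc i) ≡ + 0 + + (n C i) * + suc n
    absorption = begin
      + suc i * + (suc n C suc i)     ≡⟨ ℤₚ.pos-* (suc i) (suc n C suc i) ⟨
      + (suc i ℕ.* (suc n C suc i))   ≡⟨ cong +_ ([k+1]*[n+1]C[k+1]≡[n+1]*nCk n i) ⟩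
      + (suc n ℕ.* (n C i))           ≡⟨ ℤₚ.pos-* (suc n) (n C i) ⟩
      + suc n * + (n C i)             ≡⟨ ℤₚ.*-comm (+ suc n) (+ (n C i)) ⟩
      + (n C i) * + suc n             ≡⟨ ℤₚ.+-identityˡ _ ⟨
      + 0 + + (n C i) * + suc n       ∎

  2^p≈2 : (+ 2) ^ suc n ≈ + 2
  2^p≈2 = begin
    (+ 2) ^ suc n                                                ≡⟨ binomial (suc n) (+ 1) (+ 1) ⟨
    (powers (+ 1) ⋆ powers (+ 1)) (suc n)                        ≡⟨ sum-cong (suc (suc n)) (λ i _ → ones i) ⟩
    sumTo (suc (suc n)) (λ i → + (suc n C i))                    ≡⟨ sum-suc (suc n) _ ⟩
    + 1 + (sumTo n (λ i → + (suc n C suc i)) + + (suc n C suc n))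
      ≈⟨ +-cong (≈-refl {+ 1}) (+-cong (sum-cong≈ n (λ i → pC[i+1]≈0 i)) (≡⇒≈ (cong +_ (ℕC.nCn≡1 (suc n))))) ⟩
    + 1 + (sumTo n (λ _ → + 0) + + 1)                            ≡⟨ cong (λ z → + 1 + (z + + 1)) (sum-zero n _ (λ _ _ → refl)) ⟩
    + 2                                                          ∎
    where
    open ≈-Reasoning
    ones : ∀ i → + (suc n C i) * (+ 1) ^ i * (+ 1) ^ (suc n ∸ i) ≡ + (suc n C i)
    ones i rewrite ℤₚ.^-zeroˡ i | ℤₚ.^-zeroˡ (suc n ∸ i) = trans (ℤₚ.*-identityʳ _) (ℤₚ.*-identityʳ (+ (suc n C i)))

  two^[p-1]≈1 : 2 < suc n → (+ 2) ^ n ≈ + 1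
  two^[p-1]≈1 2<p = ≈-trans (≡⇒≈ (lemma ((+ 2) ^ n))) (+-cong (*≈0⇒≈0 2 _ (s≤s z≤n) 2<p twice≈0) (≈-refl {+ 1}))
    where
    lemma : ∀ x → x ≡ x - + 1 + + 1
    lemma = solve-∀
    twice≈0 : + 2 * ((+ 2) ^ n - + 1) ≈ + 0
    twice≈0 = ≈-trans (≡⇒≈ (ℤₚ.*-distribˡ-+ (+ 2) ((+ 2) ^ n) (- + 1))) (-‿cong₂ 2^p≈2 (≈-refl {+ 2}))

  powerSum-vanishes : ∀ j → suc j < suc n → powerSum (suc n) j ≈ + 0
  powerSum-vanishes = <-rec (λ j → suc j < suc n → powerSum (suc n) j ≈ + 0) step
    where
    step : ∀ j → (∀ {i} → i < j → suc i < suc n → powerSum (suc n) i ≈ + 0) → suc j < suc n → powerSum (suc n) j ≈ + 0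
    step j below j+1<p = *≈0⇒≈0 (suc j) (powerSum (suc n) j) (s≤s z≤n) j+1<p (begin
      + suc j * powerSum (suc n) j                     ≡⟨ cong (λ c → + c * powerSum (suc n) j) (sym j+1Cj) ⟩
      + (suc j C j) * powerSum (suc n) j               ≡⟨ lemma lower (+ (suc j C j) * powerSum (suc n) j) ⟩
      lower + + (suc j C j) * powerSum (suc n) j - lower
        ≡⟨ cong (_- lower) (powerSum-recurrence (suc n) j) ⟨
      (+ suc n) ^ suc j - lower                        ≈⟨ -‿cong₂ (*-cong P≈0 (≈-refl {(+ suc n) ^ j})) lower≈0 ⟩
      + 0 * (+ suc n) ^ j - + 0                        ≡⟨ cong (_- + 0) (ℤₚ.*-zeroˡ ((+ suc n) ^ j)) ⟩
      + 0                                              ∎)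
      where
      open ≈-Reasoning
      lower : ℤ
      lower = sumTo j (λ i → + (suc j C i) * powerSum (suc n) i)
      lower≈0 : lower ≈ + 0
      lower≈0 = ≈-trans (sum-cong≈ j (λ i i<j → *-congˡ (+ (suc j C i)) (below i<j (ℕₚ.<-trans (s≤s i<j) j+1<p))))
                        (≡⇒≈ (sum-zero j _ (λ i _ → ℤₚ.*-zeroʳ (+ (suc j C i)))))
      j+1Cj : suc j C j ≡ suc j
      j+1Cj = trans (ℕC.nCk≡nC[n∸k] (ℕₚ.n≤1+n j)) (trans (cong (suc j C_) (ℕₚ.m+n∸n≡m 1 j)) (ℕC.nC1≡n (suc j)))
      lemma : ∀ a b → b ≡ a + b - a
      lemma = solve-∀

inInterval : (p a b c d s : ℕ) → Bool
inInterval p a b c d s = (a ℕ.* p <ᵇ b ℕ.* s) ∧ (d ℕ.* s <ᵇ c ℕ.* p)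

intervalTerm : (p ℓ a b c d s : ℕ) → ℤ
intervalTerm p ℓ a b c d s = if inInterval p a b c d s then (+ s) ^ ℓ else + 0

<ᵇ-cong-⇔ : ∀ {x y z w} → (x < y → z < w) → (z < w → x < y) → (x <ᵇ y) ≡ (z <ᵇ w)
<ᵇ-cong-⇔ {x} {y} {z} {w} to from with z ℕ.<? w
... | yes z<w = trans (<ᵇ-true (from z<w)) (sym (<ᵇ-true z<w))
... | no  z≮w = trans (<ᵇ-false (λ x<y → z≮w (to x<y))) (sym (<ᵇ-false z≮w))

<ᵇ-*-cancel : ∀ k x y → (suc k ℕ.* x <ᵇ suc k ℕ.* y) ≡ (x <ᵇ y)
<ᵇ-*-cancel k x y = <ᵇ-cong-⇔ (ℕₚ.*-cancelˡ-< (suc k) x y) (ℕₚ.*-monoʳ-< (suc k))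

<ᵇ-+-cancel : ∀ x y z → (x ℕ.+ z <ᵇ y ℕ.+ z) ≡ (x <ᵇ y)
<ᵇ-+-cancel x y z = <ᵇ-cong-⇔ (ℕₚ.+-cancelʳ-< z x y) (ℕₚ.+-monoˡ-< z)

S-rescale : ∀ p ℓ a b c d k l → S p ℓ a b c d ≡ S p ℓ (suc k ℕ.* a) (suc k ℕ.* b) (suc l ℕ.* c) (suc l ℕ.* d)
S-rescale p ℓ a b c d k l =
  sum-cong (suc p) (λ s _ → cong (λ β → if β then (+ s) ^ ℓ else + 0) (cong₂ _∧_ (lower s) (upper s)))
  where
  lower : ∀ s → (a ℕ.* p <ᵇ b ℕ.* s) ≡ (suc k ℕ.* a ℕ.* p <ᵇ suc k ℕ.* b ℕ.* s)
  lower s rewrite ℕₚ.*-assoc (suc k) a p | ℕₚ.*-assoc (suc k) b s = sym (<ᵇ-*-cancel k (a ℕ.* p) (b ℕ.* s))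
  upper : ∀ s → (d ℕ.* s <ᵇ c ℕ.* p) ≡ (suc l ℕ.* d ℕ.* s <ᵇ suc l ℕ.* c ℕ.* p)
  upper s rewrite ℕₚ.*-assoc (suc l) d s | ℕₚ.*-assoc (suc l) c p = sym (<ᵇ-*-cancel l (d ℕ.* s) (c ℕ.* p))

S-split : ∀ p ℓ a b c N → a ≤ b → b ≤ c → (∀ s → N ℕ.* s ≢ b ℕ.* p) →
  S p ℓ a N c N ≡ S p ℓ a N b N + S p ℓ b N c N
S-split p ℓ a b c N a≤b b≤c N*s≢b*p = trans (sum-cong (suc p) (λ s _ → split s)) (sum-+ (suc p) _ _)
  where
  split : ∀ s → intervalTerm p ℓ a N c N s ≡ intervalTerm p ℓ a N b N s + intervalTerm p ℓ b N c N s
  split s with ℕₚ.<-cmp (N ℕ.* s) (b ℕ.* p)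
  ... | tri< lt _ _
    rewrite <ᵇ-true lt | <ᵇ-false (ℕₚ.<⇒≯ lt) | <ᵇ-true (ℕₚ.<-≤-trans lt (ℕₚ.*-monoˡ-≤ p b≤c))
    with a ℕ.* p <ᵇ N ℕ.* s
  ...   | true  = sym (ℤₚ.+-identityʳ _)
  ...   | false = refl
  split s | tri≈ _ eq _ = ⊥-elim (N*s≢b*p s eq)
  split s | tri> _ _ gt
    rewrite <ᵇ-true gt | <ᵇ-false (ℕₚ.<⇒≯ gt) | <ᵇ-true (ℕₚ.≤-<-trans (ℕₚ.*-monoˡ-≤ p a≤b) gt)
    with N ℕ.* s <ᵇ c ℕ.* p
  ...   | true  = sym (ℤₚ.+-identityˡ _)
  ...   | false = refl

*-^ : ∀ (x y : ℤ) n → (x * y) ^ n ≡ x ^ n * y ^ n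
*-^ x y zero    = refl
*-^ x y (suc n) rewrite *-^ x y n = lemma x y (x ^ n) (y ^ n)
  where
  lemma : ∀ x y a b → x * y * (a * b) ≡ x * a * (y * b)
  lemma = solve-∀

*-if : ∀ (b : Bool) (x y : ℤ) → x * (if b then y else + 0) ≡ (if b then x * y else + 0)
*-if true  x y = refl
*-if false x y = ℤₚ.*-zeroʳ x

-- Reflecting s ↦ N p - s exchanges the interval (a/N, c/N) with ((N-c)/N, (N-a)/N).
inInterval-reflect : ∀ p a c N Y V → a ≤ N → c ≤ N → Y ℕ.+ V ≡ N ℕ.* p →
  ((a ℕ.* p <ᵇ Y) ∧ (Y <ᵇ c ℕ.* p)) ≡ (((N ∸ c) ℕ.* p <ᵇ V) ∧ (V <ᵇ (N ∸ a) ℕ.* p))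
inInterval-reflect p a c N Y V a≤N c≤N Y+V≡Np =
  trans (cong₂ _∧_ (reflectˡ a a≤N) (reflectʳ c c≤N))
        (∧-comm (V <ᵇ (N ∸ a) ℕ.* p) ((N ∸ c) ℕ.* p <ᵇ V))
  where
  complement : ∀ x → x ≤ N → (N ∸ x) ℕ.* p ℕ.+ x ℕ.* p ≡ N ℕ.* p
  complement x x≤N = trans (sym (ℕₚ.*-distribʳ-+ p (N ∸ x) x)) (cong (ℕ._* p) (ℕₚ.m∸n+n≡m x≤N))
  reflectˡ : ∀ x → x ≤ N → (x ℕ.* p <ᵇ Y) ≡ (V <ᵇ (N ∸ x) ℕ.* p)
  reflectˡ x x≤N = begin
    (x ℕ.* p <ᵇ Y)                                ≡⟨ <ᵇ-+-cancel (x ℕ.* p) Y V ⟨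
    (x ℕ.* p ℕ.+ V <ᵇ Y ℕ.+ V)                    ≡⟨ cong₂ _<ᵇ_ (ℕₚ.+-comm (x ℕ.* p) V) (trans Y+V≡Np (sym (complement x x≤N))) ⟩
    (V ℕ.+ x ℕ.* p <ᵇ (N ∸ x) ℕ.* p ℕ.+ x ℕ.* p) ≡⟨ <ᵇ-+-cancel V ((N ∸ x) ℕ.* p) (x ℕ.* p) ⟩
    (V <ᵇ (N ∸ x) ℕ.* p)                          ∎
    where open ≡-Reasoning
  reflectʳ : ∀ x → x ≤ N → (Y <ᵇ x ℕ.* p) ≡ ((N ∸ x) ℕ.* p <ᵇ V)
  reflectʳ x x≤N = begin
    (Y <ᵇ x ℕ.* p)                                ≡⟨ <ᵇ-+-cancel Y (x ℕ.* p) V ⟨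
    (Y ℕ.+ V <ᵇ x ℕ.* p ℕ.+ V)                    ≡⟨ cong₂ _<ᵇ_ (trans Y+V≡Np (sym (complement x x≤N))) (ℕₚ.+-comm (x ℕ.* p) V) ⟩
    ((N ∸ x) ℕ.* p ℕ.+ x ℕ.* p <ᵇ V ℕ.+ x ℕ.* p) ≡⟨ <ᵇ-+-cancel ((N ∸ x) ℕ.* p) V (x ℕ.* p) ⟩
    ((N ∸ x) ℕ.* p <ᵇ V)                          ∎
    where open ≡-Reasoning

module _ (m ℓ : ℕ) where

  beyond-half : ∀ a c N u → c ≤ N → suc m ≤ u → intervalTerm (suc (2 ℕ.* m)) ℓ a (2 ℕ.* N) c (2 ℕ.* N) u ≡ + 0
  beyond-half a c N u c≤N m<u = vanish
    where
    cp≤2Nu : c ℕ.* suc (2 ℕ.* m) ≤ 2 ℕ.* N ℕ.* u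
    cp≤2Nu = begin
      c ℕ.* suc (2 ℕ.* m)         ≤⟨ ℕₚ.*-monoˡ-≤ (suc (2 ℕ.* m)) c≤N ⟩
      N ℕ.* suc (2 ℕ.* m)         ≤⟨ ℕₚ.*-monoʳ-≤ N (ℕₚ.n≤1+n _) ⟩
      N ℕ.* suc (suc (2 ℕ.* m))   ≡⟨ lemma N m ⟩
      2 ℕ.* N ℕ.* suc m           ≤⟨ ℕₚ.*-monoʳ-≤ (2 ℕ.* N) m<u ⟩
      2 ℕ.* N ℕ.* u               ∎
      where
      open ℕₚ.≤-Reasoning
      lemma : ∀ N m → N ℕ.* suc (suc (2 ℕ.* m)) ≡ 2 ℕ.* N ℕ.* suc m
      lemma = ℕ-Solver.solve-∀
    vanish : intervalTerm (suc (2 ℕ.* m)) ℓ a (2 ℕ.* N) c (2 ℕ.* N) u ≡ + 0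
    vanish rewrite <ᵇ-false (ℕₚ.≤⇒≯ cp≤2Nu) | ∧-zeroʳ (a ℕ.* suc (2 ℕ.* m) <ᵇ 2 ℕ.* N ℕ.* u) = refl

  S-below-half : ∀ a c N → c ≤ N →
    S (suc (2 ℕ.* m)) ℓ a (2 ℕ.* N) c (2 ℕ.* N) ≡ sumTo (suc m) (intervalTerm (suc (2 ℕ.* m)) ℓ a (2 ℕ.* N) c (2 ℕ.* N))
  S-below-half a c N c≤N =
    sum-vanishing-tail _ (s≤s (ℕₚ.≤-trans (ℕₚ.m≤m+n m (m ℕ.+ 0)) (ℕₚ.n≤1+n _))) (λ u → beyond-half a c N u c≤N)

  S-evens : ∀ a c N → c ≤ N →
    sumTo (suc m) (λ u → intervalTerm (suc (2 ℕ.* m)) ℓ a N c N (2 ℕ.* u))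
      ≡ (+ 2) ^ ℓ * S (suc (2 ℕ.* m)) ℓ a (2 ℕ.* N) c (2 ℕ.* N)
  S-evens a c N c≤N = begin
    sumTo (suc m) (λ u → intervalTerm p ℓ a N c N (2 ℕ.* u))        ≡⟨ sum-cong (suc m) (λ u _ → doubled u) ⟩
    sumTo (suc m) (λ u → (+ 2) ^ ℓ * intervalTerm p ℓ a N′ c N′ u)  ≡⟨ sum-*ˡ (suc m) ((+ 2) ^ ℓ) _ ⟩
    (+ 2) ^ ℓ * sumTo (suc m) (intervalTerm p ℓ a N′ c N′)          ≡⟨ cong ((+ 2) ^ ℓ *_) (S-below-half a c N c≤N) ⟨
    (+ 2) ^ ℓ * S p ℓ a N′ c N′                                      ∎
    where
    open ≡-Reasoning
    p N′ : ℕ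
    p  = suc (2 ℕ.* m)
    N′ = 2 ℕ.* N
    lemma : ∀ N u → N ℕ.* (2 ℕ.* u) ≡ 2 ℕ.* N ℕ.* u
    lemma = ℕ-Solver.solve-∀
    doubled : ∀ u → intervalTerm p ℓ a N c N (2 ℕ.* u) ≡ (+ 2) ^ ℓ * intervalTerm p ℓ a N′ c N′ u
    doubled u = begin
      intervalTerm p ℓ a N c N (2 ℕ.* u)
        ≡⟨ cong (λ z → if (a ℕ.* p <ᵇ z) ∧ (z <ᵇ c ℕ.* p) then (+ (2 ℕ.* u)) ^ ℓ else + 0) (lemma N u) ⟩
      (if inInterval p a N′ c N′ u then (+ (2 ℕ.* u)) ^ ℓ else + 0)
        ≡⟨ cong (λ v → if inInterval p a N′ c N′ u then v else + 0) (trans (cong (_^ ℓ) (ℤₚ.pos-* 2 u)) (*-^ (+ 2) (+ u) ℓ)) ⟩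
      (if inInterval p a N′ c N′ u then (+ 2) ^ ℓ * (+ u) ^ ℓ else + 0)
        ≡⟨ *-if (inInterval p a N′ c N′ u) ((+ 2) ^ ℓ) ((+ u) ^ ℓ) ⟨
      (+ 2) ^ ℓ * intervalTerm p ℓ a N′ c N′ u
        ∎

module _ (m e : ℕ) where
  open Modulo (+ suc (2 ℕ.* m))

  even-power-reflect : ∀ s r → s ℕ.+ r ≡ suc (2 ℕ.* m) → (+ s) ^ (2 ℕ.* e) ≈ (+ r) ^ (2 ℕ.* e)
  even-power-reflect s r s+r≡p = ≈-trans (^-congˡ (2 ℕ.* e) s≈-r) (≡⇒≈ neg-even)
    where
    s≈-r : + s ≈ - (+ r)
    s≈-r = + 1 , trans (lemma (+ s) (+ r)) (cong (λ z → - (+ r) + + 1 * z) (trans (sym (ℤₚ.pos-+ s r)) (cong +_ s+r≡p)))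
      where
      lemma : ∀ x y → x ≡ - y + + 1 * (x + y)
      lemma = solve-∀
    neg-even : (- (+ r)) ^ (2 ℕ.* e) ≡ (+ r) ^ (2 ℕ.* e)
    neg-even = trans (sym (ℤₚ.^-*-assoc (- (+ r)) 2 e)) (trans (cong (_^ e) (lemma (+ r))) (ℤₚ.^-*-assoc (+ r) 2 e))
      where
      lemma : ∀ x → (- x) * ((- x) * + 1) ≡ x * (x * + 1)
      lemma = solve-∀

  if-cong≈ : ∀ (b : Bool) {x y} → x ≈ y → (if b then x else + 0) ≈ (if b then y else + 0)
  if-cong≈ true  x≈y = x≈y
  if-cong≈ false _   = ≈-refl

  S-odds : ∀ a c N → a ≤ N → c ≤ N →
    sumTo (suc m) (λ u → intervalTerm (suc (2 ℕ.* m)) (2 ℕ.* e) a N c N (suc (2 ℕ.* u)))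
      ≈ (+ 2) ^ (2 ℕ.* e) * S (suc (2 ℕ.* m)) (2 ℕ.* e) (N ∸ c) (2 ℕ.* N) (N ∸ a) (2 ℕ.* N)
  S-odds a c N a≤N c≤N = begin
    sumTo (suc m) (λ u → intervalTerm p ℓ a N c N (suc (2 ℕ.* u)))
      ≡⟨ sum-reverse (suc m) _ ⟩
    sumTo (suc m) (λ v → intervalTerm p ℓ a N c N (suc (2 ℕ.* (m ∸ v))))
      ≈⟨ sum-cong≈ (suc m) (λ v v≤m → reflected v (ℕₚ.≤-pred v≤m)) ⟩
    sumTo (suc m) (λ v → (+ 2) ^ ℓ * intervalTerm p ℓ (N ∸ c) N′ (N ∸ a) N′ v)
      ≡⟨ sum-*ˡ (suc m) ((+ 2) ^ ℓ) _ ⟩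
    (+ 2) ^ ℓ * sumTo (suc m) (intervalTerm p ℓ (N ∸ c) N′ (N ∸ a) N′)
      ≡⟨ cong ((+ 2) ^ ℓ *_) (S-below-half m ℓ (N ∸ c) (N ∸ a) N (ℕₚ.m∸n≤m N a)) ⟨
    (+ 2) ^ ℓ * S p ℓ (N ∸ c) N′ (N ∸ a) N′
      ∎
    where
    open ≈-Reasoning
    p ℓ N′ : ℕ
    p  = suc (2 ℕ.* m)
    ℓ  = 2 ℕ.* e
    N′ = 2 ℕ.* N
    reflected : ∀ v → v ≤ m →
      intervalTerm p ℓ a N c N (suc (2 ℕ.* (m ∸ v))) ≈ (+ 2) ^ ℓ * intervalTerm p ℓ (N ∸ c) N′ (N ∸ a) N′ v
    reflected v v≤m = begin
      intervalTerm p ℓ a N c N s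
        ≡⟨ cong (λ b → if b then (+ s) ^ ℓ else + 0) condition ⟩
      (if inInterval p (N ∸ c) N′ (N ∸ a) N′ v then (+ s) ^ ℓ else + 0)
        ≈⟨ if-cong≈ (inInterval p (N ∸ c) N′ (N ∸ a) N′ v) value ⟩
      (if inInterval p (N ∸ c) N′ (N ∸ a) N′ v then (+ 2) ^ ℓ * (+ v) ^ ℓ else + 0)
        ≡⟨ *-if (inInterval p (N ∸ c) N′ (N ∸ a) N′ v) ((+ 2) ^ ℓ) ((+ v) ^ ℓ) ⟨
      (+ 2) ^ ℓ * intervalTerm p ℓ (N ∸ c) N′ (N ∸ a) N′ v
        ∎
      where
      s = suc (2 ℕ.* (m ∸ v))
      s+2v≡p : s ℕ.+ 2 ℕ.* v ≡ p
      s+2v≡p = trans (lemma (m ∸ v) v) (cong (λ z → suc (2 ℕ.* z)) (ℕₚ.m∸n+n≡m v≤m))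
        where
        lemma : ∀ w v → suc (2 ℕ.* w) ℕ.+ 2 ℕ.* v ≡ suc (2 ℕ.* (w ℕ.+ v))
        lemma = ℕ-Solver.solve-∀
      condition : inInterval p a N c N s ≡ inInterval p (N ∸ c) N′ (N ∸ a) N′ v
      condition = inInterval-reflect p a c N (N ℕ.* s) (N′ ℕ.* v) a≤N c≤N
                    (trans (lemma N s v) (cong (N ℕ.*_) s+2v≡p))
        where
        lemma : ∀ N s v → N ℕ.* s ℕ.+ 2 ℕ.* N ℕ.* v ≡ N ℕ.* (s ℕ.+ 2 ℕ.* v)
        lemma = ℕ-Solver.solve-∀
      value : (+ s) ^ ℓ ≈ (+ 2) ^ ℓ * (+ v) ^ ℓ
      value = ≈-trans (even-power-reflect s (2 ℕ.* v) s+2v≡p) (≡⇒≈ (trans (cong (_^ ℓ) (ℤₚ.pos-* 2 v)) (*-^ (+ 2) (+ v) ℓ)))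

  -- Split [0, p] into even s = 2u and odd s = p - 2v.
  S-doubling : ∀ a c N → a ≤ N → c ≤ N →
    S (suc (2 ℕ.* m)) (2 ℕ.* e) a N c N
      ≈ (+ 2) ^ (2 ℕ.* e) * (S (suc (2 ℕ.* m)) (2 ℕ.* e) a (2 ℕ.* N) c (2 ℕ.* N)
                           + S (suc (2 ℕ.* m)) (2 ℕ.* e) (N ∸ c) (2 ℕ.* N) (N ∸ a) (2 ℕ.* N))
  S-doubling a c N a≤N c≤N = begin
    S p ℓ a N c N
      ≡⟨ sum-evenOdd′ m _ ⟩
    sumTo (suc m) (λ u → intervalTerm p ℓ a N c N (2 ℕ.* u)) + sumTo (suc m) (λ u → intervalTerm p ℓ a N c N (suc (2 ℕ.* u)))
      ≈⟨ +-cong (≡⇒≈ (S-evens m ℓ a c N c≤N)) (S-odds a c N a≤N c≤N) ⟩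
    (+ 2) ^ ℓ * S p ℓ a (2 ℕ.* N) c (2 ℕ.* N) + (+ 2) ^ ℓ * S p ℓ (N ∸ c) (2 ℕ.* N) (N ∸ a) (2 ℕ.* N)
      ≡⟨ ℤₚ.*-distribˡ-+ ((+ 2) ^ ℓ) _ _ ⟨
    (+ 2) ^ ℓ * (S p ℓ a (2 ℕ.* N) c (2 ℕ.* N) + S p ℓ (N ∸ c) (2 ℕ.* N) (N ∸ a) (2 ℕ.* N))
      ∎
    where
    open ≈-Reasoning
    p ℓ : ℕ
    p = suc (2 ℕ.* m)
    ℓ = 2 ℕ.* e

-- From Euler numbers to a quarter interval

signedPowers : ℕ → ℕ → ℤ
signedPowers t M = sumTo M (λ v → -1ℤ ^ suc v * (+ suc v) ^ t)

module _ (m j : ℕ) where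
  open Modulo (+ suc (2 ℕ.* m))

  private
    p t : ℕ
    p = suc (2 ℕ.* m)
    t = 2 ℕ.* suc j

  halfInterval-weighted : ∀ (w : ℕ → ℤ) →
    sumTo (suc p) (λ s → w s * intervalTerm p t 0 2 1 2 s) ≡ sumTo m (λ v → w (suc v) * (+ suc v) ^ t)
  halfInterval-weighted w = begin
    sumTo (suc p) (λ s → w s * intervalTerm p t 0 2 1 2 s)
      ≡⟨ sum-vanishing-tail _ (s≤s (ℕₚ.≤-trans (ℕₚ.m≤m+n m (m ℕ.+ 0)) (ℕₚ.n≤1+n _))) beyond ⟩
    sumTo (suc m) (λ s → w s * intervalTerm p t 0 2 1 2 s)
      ≡⟨ sum-suc m _ ⟩
    w 0 * + 0 + sumTo m (λ v → w (suc v) * intervalTerm p t 0 2 1 2 (suc v))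
      ≡⟨ cong₂ _+_ (ℤₚ.*-zeroʳ (w 0)) (sum-cong m (λ v v<m → cong (w (suc v) *_) (inside v v<m))) ⟩
    + 0 + sumTo m (λ v → w (suc v) * (+ suc v) ^ t)
      ≡⟨ ℤₚ.+-identityˡ _ ⟩
    sumTo m (λ v → w (suc v) * (+ suc v) ^ t)
      ∎
    where
    open ≡-Reasoning
    beyond : ∀ s → suc m ≤ s → w s * intervalTerm p t 0 2 1 2 s ≡ + 0
    beyond s m<s = trans (cong (w s *_) (beyond-half m t 0 1 1 s (s≤s z≤n) m<s)) (ℤₚ.*-zeroʳ (w s))
    inside : ∀ v → v < m → intervalTerm p t 0 2 1 2 (suc v) ≡ (+ suc v) ^ t
    inside v v<m
      rewrite <ᵇ-true {2 ℕ.* suc v} {1 ℕ.* p} (subst (2 ℕ.* suc v <_) (sym (ℕₚ.*-identityˡ p)) (s≤s (ℕₚ.*-monoʳ-≤ 2 v<m)))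
      = refl

  signedPowers-via-S : signedPowers t m ≡ + 2 * ((+ 2) ^ t * S p t 0 4 1 4) - S p t 0 2 1 2
  signedPowers-via-S = begin
    signedPowers t m
      ≡⟨ halfInterval-weighted (-1ℤ ^_) ⟨
    sumTo (suc p) (λ s → -1ℤ ^ s * f s)
      ≡⟨ sum-evenOdd′ m _ ⟩
    sumTo (suc m) (λ u → -1ℤ ^ (2 ℕ.* u) * f (2 ℕ.* u)) + sumTo (suc m) (λ u → -1ℤ ^ suc (2 ℕ.* u) * f (suc (2 ℕ.* u)))
      ≡⟨ cong₂ _+_ (sum-cong (suc m) (λ u _ → evenSign u)) (trans (sum-cong (suc m) (λ u _ → oddSign u)) (sum-*ˡ (suc m) -1ℤ _)) ⟩
    evens + -1ℤ * odds
      ≡⟨ lemma evens odds ⟩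
    + 2 * evens - (evens + odds)
      ≡⟨ cong₂ (λ x y → + 2 * x - y) (S-evens m t 0 1 2 (s≤s z≤n)) (sym (sum-evenOdd′ m f)) ⟩
    + 2 * ((+ 2) ^ t * S p t 0 4 1 4) - S p t 0 2 1 2
      ∎
    where
    open ≡-Reasoning
    f : ℕ → ℤ
    f = intervalTerm p t 0 2 1 2
    evens odds : ℤ
    evens = sumTo (suc m) (λ u → f (2 ℕ.* u))
    odds  = sumTo (suc m) (λ u → f (suc (2 ℕ.* u)))
    evenSign : ∀ u → -1ℤ ^ (2 ℕ.* u) * f (2 ℕ.* u) ≡ f (2 ℕ.* u)
    evenSign u = trans (cong (_* f (2 ℕ.* u)) (-1^-even u)) (ℤₚ.*-identityˡ _)
    oddSign : ∀ u → -1ℤ ^ suc (2 ℕ.* u) * f (suc (2 ℕ.* u)) ≡ -1ℤ * f (suc (2 ℕ.* u))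
    oddSign u = trans (cong (λ σ → -1ℤ * σ * f (suc (2 ℕ.* u))) (-1^-even u)) (cong (_* f (suc (2 ℕ.* u))) (ℤₚ.*-identityʳ -1ℤ))
    lemma : ∀ a b → a + -1ℤ * b ≡ + 2 * a - (a + b)
    lemma = solve-∀

  alternatingOddPowers-reflect : alternatingOddPowers t m ≈ -1ℤ ^ m * (+ 2) ^ t * signedPowers t m
  alternatingOddPowers-reflect = begin
    alternatingOddPowers t m
      ≡⟨ sum-reverse m _ ⟩
    sumTo m (λ v → -1ℤ ^ (m ∸ suc v) * (+ suc (2 ℕ.* (m ∸ suc v))) ^ t)
      ≈⟨ sum-cong≈ m reflected ⟩
    sumTo m (λ v → -1ℤ ^ m * (+ 2) ^ t * (-1ℤ ^ suc v * (+ suc v) ^ t))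
      ≡⟨ sum-*ˡ m (-1ℤ ^ m * (+ 2) ^ t) _ ⟩
    -1ℤ ^ m * (+ 2) ^ t * signedPowers t m
      ∎
    where
    open ≈-Reasoning
    reflected : ∀ v → v < m →
      -1ℤ ^ (m ∸ suc v) * (+ suc (2 ℕ.* (m ∸ suc v))) ^ t ≈ -1ℤ ^ m * (+ 2) ^ t * (-1ℤ ^ suc v * (+ suc v) ^ t)
    reflected v v<m = begin
      -1ℤ ^ (m ∸ suc v) * (+ suc (2 ℕ.* (m ∸ suc v))) ^ t
        ≈⟨ *-cong (≡⇒≈ (-1^-∸ v<m)) (even-power-reflect m (suc j) _ (2 ℕ.* suc v) sum≡p) ⟩
      -1ℤ ^ m * -1ℤ ^ suc v * (+ (2 ℕ.* suc v)) ^ t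
        ≡⟨ cong (-1ℤ ^ m * -1ℤ ^ suc v *_) (trans (cong (_^ t) (ℤₚ.pos-* 2 (suc v))) (*-^ (+ 2) (+ suc v) t)) ⟩
      -1ℤ ^ m * -1ℤ ^ suc v * ((+ 2) ^ t * (+ suc v) ^ t)
        ≡⟨ lemma (-1ℤ ^ m) (-1ℤ ^ suc v) ((+ 2) ^ t) ((+ suc v) ^ t) ⟩
      -1ℤ ^ m * (+ 2) ^ t * (-1ℤ ^ suc v * (+ suc v) ^ t)
        ∎
      where
      sum≡p : suc (2 ℕ.* (m ∸ suc v)) ℕ.+ 2 ℕ.* suc v ≡ p
      sum≡p = trans (lemma′ (m ∸ suc v) (suc v)) (cong (λ z → suc (2 ℕ.* z)) (ℕₚ.m∸n+n≡m v<m))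
        where
        lemma′ : ∀ a b → suc (2 ℕ.* a) ℕ.+ 2 ℕ.* b ≡ suc (2 ℕ.* (a ℕ.+ b))
        lemma′ = ℕ-Solver.solve-∀
      lemma : ∀ a b x y → a * b * (x * y) ≡ a * x * (b * y)
      lemma = solve-∀

  S-half≈0 : Prime p → suc t < p → S p t 0 2 1 2 ≈ + 0
  S-half≈0 p-prime t+1<p = ≈-trans (≡⇒≈ lowerHalf) (*≈0⇒≈0 p-prime 2 half (s≤s z≤n) 2<p twoHalves≈0)
    where
    half : ℤ
    half = sumTo m (λ v → (+ suc v) ^ t)
    2<p : 2 < p
    2<p = ℕₚ.≤-trans (s≤s (s≤s (s≤s z≤n))) t+1<p
    p≡m+1+m : p ≡ suc m ℕ.+ m
    p≡m+1+m = cong suc (cong (m ℕ.+_) (ℕₚ.+-identityʳ m))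
    lowerHalf : S p t 0 2 1 2 ≡ half
    lowerHalf = begin
      S p t 0 2 1 2                                            ≡⟨ sum-cong (suc p) (λ s _ → ℤₚ.*-identityˡ _) ⟨
      sumTo (suc p) (λ s → + 1 * intervalTerm p t 0 2 1 2 s)   ≡⟨ halfInterval-weighted (λ _ → + 1) ⟩
      sumTo m (λ v → + 1 * (+ suc v) ^ t)                      ≡⟨ sum-cong m (λ v _ → ℤₚ.*-identityˡ _) ⟩
      half                                                     ∎
      where open ≡-Reasoning
    upperHalf : sumTo m (λ i → (+ (suc m ℕ.+ i)) ^ t) ≈ half
    upperHalf = ≈-trans (≡⇒≈ (sum-reverse m _)) (sum-cong≈ m (λ v v<m →
      even-power-reflect m (suc j) (suc m ℕ.+ (m ∸ suc v)) (suc v)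
        (trans (ℕₚ.+-assoc (suc m) (m ∸ suc v) (suc v)) (trans (cong (suc m ℕ.+_) (ℕₚ.m∸n+n≡m v<m)) (sym p≡m+1+m)))))
    twoHalves≈0 : + 2 * half ≈ + 0
    twoHalves≈0 = begin
      + 2 * half                                                ≡⟨ lemma half ⟩
      + 0 + half + half                                         ≈⟨ +-cong (≡⇒≈ (sym (sum-suc m (λ s → (+ s) ^ t)))) (≈-sym upperHalf) ⟩
      sumTo (suc m) (λ s → (+ s) ^ t) + sumTo m (λ i → (+ (suc m ℕ.+ i)) ^ t)
        ≡⟨ sum-++ (suc m) m (λ s → (+ s) ^ t) ⟨
      powerSum (suc m ℕ.+ m) t                                  ≡⟨ cong (λ n → powerSum n t) p≡m+1+m ⟨
      powerSum p t                                              ≈⟨ powerSum-vanishes p-prime t t+1<p ⟩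
      + 0                                                       ∎
      where
      open ≈-Reasoning
      lemma : ∀ x → + 2 * x ≡ + 0 + x + x
      lemma = solve-∀

  sech≈quarter : Prime p → suc t < p → sech t ≈ + 4 * -1ℤ ^ m * (+ 2) ^ t * (+ 2) ^ t * S p t 0 4 1 4
  sech≈quarter p-prime t+1<p = begin
    sech t                                                      ≈⟨ alternatingOddPowers≈sech m j ⟨
    + 2 * alternatingOddPowers t m                              ≈⟨ *-congˡ (+ 2) alternatingOddPowers-reflect ⟩
    + 2 * (σ * X * signedPowers t m)                            ≡⟨ cong (λ x → + 2 * (σ * X * x)) signedPowers-via-S ⟩
    + 2 * (σ * X * (+ 2 * (X * quarter) - S p t 0 2 1 2))      ≈⟨ *-congˡ (+ 2) (*-congˡ (σ * X) (-‿cong₂ (≈-refl {+ 2 * (X * quarter)}) (S-half≈0 p-prime t+1<p))) ⟩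
    + 2 * (σ * X * (+ 2 * (X * quarter) - + 0))                 ≡⟨ lemma σ X quarter ⟩
    + 4 * σ * X * X * quarter                                   ∎
    where
    open ≈-Reasoning
    σ X quarter : ℤ
    σ = -1ℤ ^ m
    X = (+ 2) ^ t
    quarter = S p t 0 4 1 4
    lemma : ∀ σ X q → + 2 * (σ * X * (+ 2 * (X * q) - + 0)) ≡ + 4 * σ * X * X * q
    lemma = solve-∀

-- Expanding the quarter interval

odd-boundary : ∀ m N′ b′ s → 2 ℕ.* N′ ℕ.* s ≢ suc (2 ℕ.* b′) ℕ.* suc (2 ℕ.* m)
odd-boundary m N′ b′ s eq = ℕₚ.even≢odd (N′ ℕ.* s) (b′ ℕ.+ m ℕ.+ 2 ℕ.* b′ ℕ.* m)
  (trans (sym (ℕₚ.*-assoc 2 N′ s)) (trans eq (lemma b′ m)))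
  where
  lemma : ∀ b m → suc (2 ℕ.* b) ℕ.* suc (2 ℕ.* m) ≡ suc (2 ℕ.* (b ℕ.+ m ℕ.+ 2 ℕ.* b ℕ.* m))
  lemma = ℕ-Solver.solve-∀

module _ (m e : ℕ) where
  open Modulo (+ suc (2 ℕ.* m))

  private
    p t : ℕ
    p = suc (2 ℕ.* m)
    t = 2 ℕ.* e
    X : ℤ
    X = (+ 2) ^ t

    S₀ S₁ S₂ S₃ S₄ : ℤ
    S₀ = S p t 0 64 1 64
    S₁ = S p t 6 16 7 16
    S₂ = S p t 14 32 15 32
    S₃ = S p t 30 64 31 64
    S₄ = S p t 31 64 32 64

  quarter-expansion :
    S p t 0 4 1 4 ≈ (+ 16) ^ t * S p t 0 1 1 64
                    + (+ 2) ^ t * S p t 3 8 7 16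
                    + ((+ 2) ^ t + (+ 4) ^ t) * S p t 7 16 15 32
                    + ((+ 2) ^ t + (+ 4) ^ t + (+ 8) ^ t) * S p t 15 32 31 64
                    + ((+ 2) ^ t + (+ 4) ^ t + (+ 8) ^ t + (+ 16) ^ t) * S p t 31 64 1 2
  quarter-expansion = begin
    S p t 0 4 1 4
      ≈⟨ quarter ⟩
    X * (X * (X * (X * (S₀ + S₄) + (S₃ + S₄)) + (S₂ + (S₃ + S₄))) + (S₁ + (S₂ + (S₃ + S₄))))
      ≡⟨ lemma X S₀ S₁ S₂ S₃ S₄ ⟩
    combination X (X * X) (X * X * X) (X * X * X * X) S₀ S₁ S₂ S₃ S₄
      ≡⟨ combination-cong {w₂ = X} w₄ w₈ w₁₆ (S-rescale p t 0 1 1 64 63 0) (S-rescale p t 3 8 7 16 1 0)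
           (S-rescale p t 7 16 15 32 1 0) (S-rescale p t 15 32 31 64 1 0) (S-rescale p t 31 64 1 2 0 31) ⟨
    combination ((+ 2) ^ t) ((+ 4) ^ t) ((+ 8) ^ t) ((+ 16) ^ t)
      (S p t 0 1 1 64) (S p t 3 8 7 16) (S p t 7 16 15 32) (S p t 15 32 31 64) (S p t 31 64 1 2)
      ∎
    where
    open ≈-Reasoning
    combination : (w₂ w₄ w₈ w₁₆ s₀ s₁ s₂ s₃ s₄ : ℤ) → ℤ
    combination w₂ w₄ w₈ w₁₆ s₀ s₁ s₂ s₃ s₄ =
      w₁₆ * s₀ + w₂ * s₁ + (w₂ + w₄) * s₂ + (w₂ + w₄ + w₈) * s₃ + (w₂ + w₄ + w₈ + w₁₆) * s₄
    combination-cong : ∀ {w₂ w₄ w₄′ w₈ w₈′ w₁₆ w₁₆′ s₀ s₀′ s₁ s₁′ s₂ s₂′ s₃ s₃′ s₄ s₄′} →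
      w₄ ≡ w₄′ → w₈ ≡ w₈′ → w₁₆ ≡ w₁₆′ → s₀ ≡ s₀′ → s₁ ≡ s₁′ → s₂ ≡ s₂′ → s₃ ≡ s₃′ → s₄ ≡ s₄′ →
      combination w₂ w₄ w₈ w₁₆ s₀ s₁ s₂ s₃ s₄ ≡ combination w₂ w₄′ w₈′ w₁₆′ s₀′ s₁′ s₂′ s₃′ s₄′
    combination-cong refl refl refl refl refl refl refl refl = refl
    w₄ : (+ 4) ^ t ≡ X * X
    w₄ = *-^ (+ 2) (+ 2) t
    w₈ : (+ 8) ^ t ≡ X * X * X
    w₈ = trans (*-^ (+ 4) (+ 2) t) (cong (_* X) w₄)
    w₁₆ : (+ 16) ^ t ≡ X * X * X * X
    w₁₆ = trans (*-^ (+ 8) (+ 2) t) (cong (_* X) w₈)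
    tail₃₂ : S p t 15 32 16 32 ≡ S₃ + S₄
    tail₃₂ = trans (S-rescale p t 15 32 16 32 1 1) (S-split p t 30 31 32 64 (ℕₚ.n≤1+n 30) (ℕₚ.n≤1+n 31) (odd-boundary m 32 15))
    tail₁₆ : S p t 7 16 8 16 ≡ S₂ + (S₃ + S₄)
    tail₁₆ = trans (S-rescale p t 7 16 8 16 1 1)
                   (trans (S-split p t 14 15 16 32 (ℕₚ.n≤1+n 14) (ℕₚ.n≤1+n 15) (odd-boundary m 16 7)) (cong (_+_ S₂) tail₃₂))
    tail₈ : S p t 3 8 4 8 ≡ S₁ + (S₂ + (S₃ + S₄))
    tail₈ = trans (S-rescale p t 3 8 4 8 1 1)
                  (trans (S-split p t 6 7 8 16 (ℕₚ.n≤1+n 6) (ℕₚ.n≤1+n 7) (odd-boundary m 8 3)) (cong (_+_ S₁) tail₁₆))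
    quarter : S p t 0 4 1 4 ≈ X * (X * (X * (X * (S₀ + S₄) + (S₃ + S₄)) + (S₂ + (S₃ + S₄))) + (S₁ + (S₂ + (S₃ + S₄))))
    quarter =
      ≈-trans (S-doubling m e 0 1 4 z≤n (s≤s z≤n)) (*-congˡ X (+-cong
      (≈-trans (S-doubling m e 0 1 8 z≤n (s≤s z≤n)) (*-congˡ X (+-cong
      (≈-trans (S-doubling m e 0 1 16 z≤n (s≤s z≤n)) (*-congˡ X (+-cong
      (S-doubling m e 0 1 32 z≤n (s≤s z≤n)) (≡⇒≈ tail₃₂)))) (≡⇒≈ tail₁₆)))) (≡⇒≈ tail₈)))
    lemma : ∀ x a b c d e →
      x * (x * (x * (x * (a + e) + (d + e)) + (c + (d + e))) + (b + (c + (d + e))))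
        ≡ x * x * x * x * a + x * b + (x + x * x) * c + (x + x * x + x * x * x) * d + (x + x * x + x * x * x + x * x * x * x) * e
    lemma = solve-∀

module _ (k′ j : ℕ) where
  private
    k m p t : ℕ
    k = suc k′
    m = k ℕ.+ suc j
    p = suc (2 ℕ.* m)
    t = 2 ℕ.* suc j
  open Modulo (+ p)

  powers-of-two : + 4 * (+ 4) ^ (2 ℕ.* k ∸ 1) * (+ 2) ^ t * (+ 2) ^ t ≡ (+ 2) ^ (2 ℕ.* m) * (+ 2) ^ (2 ℕ.* m)
  powers-of-two = begin
    (+ 4) ^ (2 ℕ.* k) * (+ 2) ^ t * (+ 2) ^ t
      ≡⟨ ℤₚ.*-assoc ((+ 4) ^ (2 ℕ.* k)) ((+ 2) ^ t) ((+ 2) ^ t) ⟩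
    (+ 4) ^ (2 ℕ.* k) * ((+ 2) ^ t * (+ 2) ^ t)
      ≡⟨ cong₂ _*_ (ℤₚ.^-*-assoc (+ 2) 2 (2 ℕ.* k)) (sym (ℤₚ.^-distribˡ-+-* (+ 2) t t)) ⟩
    (+ 2) ^ (2 ℕ.* (2 ℕ.* k)) * (+ 2) ^ (t ℕ.+ t)
      ≡⟨ ℤₚ.^-distribˡ-+-* (+ 2) (2 ℕ.* (2 ℕ.* k)) (t ℕ.+ t) ⟨
    (+ 2) ^ (2 ℕ.* (2 ℕ.* k) ℕ.+ (t ℕ.+ t))
      ≡⟨ cong ((+ 2) ^_) (lemma k j) ⟩
    (+ 2) ^ (2 ℕ.* m ℕ.+ 2 ℕ.* m)
      ≡⟨ ℤₚ.^-distribˡ-+-* (+ 2) (2 ℕ.* m) (2 ℕ.* m) ⟩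
    (+ 2) ^ (2 ℕ.* m) * (+ 2) ^ (2 ℕ.* m)
      ∎
    where
    open ≡-Reasoning
    lemma : ∀ k j → 2 ℕ.* (2 ℕ.* k) ℕ.+ (2 ℕ.* suc j ℕ.+ 2 ℕ.* suc j) ≡ 2 ℕ.* (k ℕ.+ suc j) ℕ.+ 2 ℕ.* (k ℕ.+ suc j)
    lemma = ℕ-Solver.solve-∀

  E≡sech : E t ≡ -1ℤ ^ suc j * sech t
  E≡sech = begin
    E t                                              ≡⟨ ℤₚ.*-identityˡ (E t) ⟨
    + 1 * E t                                        ≡⟨ cong (_* E t) (-1^-square (suc j)) ⟨
    -1ℤ ^ suc j * -1ℤ ^ suc j * E t                  ≡⟨ ℤₚ.*-assoc (-1ℤ ^ suc j) _ _ ⟩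
    -1ℤ ^ suc j * (-1ℤ ^ suc j * E t)                ≡⟨ cong (λ σ → -1ℤ ^ suc j * (σ * E t)) (halfSign-even (suc j)) ⟨
    -1ℤ ^ suc j * sech t                             ∎
    where open ≡-Reasoning


  E-congruence : Prime p → -1ℤ ^ k * (+ 4) ^ (2 ℕ.* k ∸ 1) * E t ≈ S p t 0 4 1 4
  E-congruence p-prime = begin
    σₖ * F * E t                                     ≡⟨ cong (σₖ * F *_) E≡sech ⟩
    σₖ * F * (σⱼ * sech t)                           ≈⟨ *-congˡ (σₖ * F) (*-congˡ σⱼ (sech≈quarter m j p-prime t+1<p)) ⟩
    σₖ * F * (σⱼ * (+ 4 * σₘ * X * X * quarter))     ≡⟨ lemma σₖ σⱼ σₘ F X quarter ⟩
    σₖ * σⱼ * σₘ * (+ 4 * F * X * X) * quarter       ≡⟨ cong₂ (λ σ x → σ * x * quarter) signs powers-of-two ⟩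
    + 1 * (Y * Y) * quarter                          ≈⟨ *-cong (*-congˡ (+ 1) (*-cong Y≈1 Y≈1)) ≈-refl ⟩
    + 1 * (+ 1 * + 1) * quarter                      ≡⟨ lemma′ quarter ⟩
    quarter                                          ∎
    where
    open ≈-Reasoning
    σₖ σⱼ σₘ F X Y quarter : ℤ
    σₖ = -1ℤ ^ k
    σⱼ = -1ℤ ^ suc j
    σₘ = -1ℤ ^ m
    F  = (+ 4) ^ (2 ℕ.* k ∸ 1)
    X  = (+ 2) ^ t
    Y  = (+ 2) ^ (2 ℕ.* m)
    quarter = S p t 0 4 1 4
    t+1<p : suc t < p
    t+1<p = s≤s (ℕₚ.*-monoʳ-< 2 (ℕₚ.m<n+m (suc j) (s≤s z≤n)))
    Y≈1 : Y ≈ + 1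
    Y≈1 = two^[p-1]≈1 p-prime (ℕₚ.≤-trans (s≤s (s≤s (s≤s z≤n))) t+1<p)
    signs : σₖ * σⱼ * σₘ ≡ + 1
    signs = trans (cong (σₖ * σⱼ *_) (ℤₚ.^-distribˡ-+-* -1ℤ k (suc j)))
                  (trans (regroup σₖ σⱼ) (cong₂ _*_ (-1^-square k) (-1^-square (suc j))))
      where
      regroup : ∀ a b → a * b * (a * b) ≡ a * a * (b * b)
      regroup = solve-∀
    lemma : ∀ a b c f x q → a * f * (b * (+ 4 * c * x * x * q)) ≡ a * b * c * (+ 4 * f * x * x) * q
    lemma = solve-∀
    lemma′ : ∀ q → + 1 * (+ 1 * + 1) * q ≡ q
    lemma′ = solve-∀

mainTheorem7-normalised : ∀ m k j t → Prime (suc (2 ℕ.* m)) → 1 ≤ k → m ≡ k ℕ.+ suc j → t ≡ 2 ℕ.* suc j →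
  (+ suc (2 ℕ.* m)) ∣ ((-1ℤ ^ k) * (+ 4) ^ (2 ℕ.* k ∸ 1) * E t
    - ((+ 16) ^ t * S (suc (2 ℕ.* m)) t 0 1 1 64
       + (+ 2) ^ t * S (suc (2 ℕ.* m)) t 3 8 7 16
       + ((+ 2) ^ t + (+ 4) ^ t) * S (suc (2 ℕ.* m)) t 7 16 15 32
       + ((+ 2) ^ t + (+ 4) ^ t + (+ 8) ^ t) * S (suc (2 ℕ.* m)) t 15 32 31 64
       + ((+ 2) ^ t + (+ 4) ^ t + (+ 8) ^ t + (+ 16) ^ t) * S (suc (2 ℕ.* m)) t 31 64 1 2))
mainTheorem7-normalised _ (suc k′) j _ p-prime (s≤s z≤n) refl refl =
  ≈⇒∣ (≈-trans (E-congruence k′ j p-prime) (quarter-expansion (suc k′ ℕ.+ suc j) (suc j)))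
  where open Modulo (+ suc (2 ℕ.* (suc k′ ℕ.+ suc j)))

prime≥5⇒odd : ∀ {p} → Prime p → 5 ≤ p → Σ ℕ (λ m → p ≡ suc (2 ℕ.* m))
prime≥5⇒odd {p} p-prime 5≤p with parity p
... | odd m  = m , refl
... | even m with prime⇒irreducible p-prime (ℕ∣.divides m (ℕₚ.*-comm 2 m))
...   | inj₁ ()
...   | inj₂ 2≡p = ⊥-elim (5≰2 (subst (5 ≤_) (sym 2≡p) 5≤p))
  where
  5≰2 : ¬ (5 ≤ 2)
  5≰2 (s≤s (s≤s ()))

2k≤p∸3⇒k<m : ∀ k m → 2 ℕ.* k ≤ suc (2 ℕ.* m) ∸ 3 → 5 ≤ suc (2 ℕ.* m) → suc k ≤ m
2k≤p∸3⇒k<m k (suc (suc m)) 2k≤p-3 _ =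
  ℕₚ.*-cancelˡ-≤ 2 (ℕₚ.≤-trans (ℕₚ.≤-reflexive (ℕₚ.*-suc 2 k)) (s≤s (s≤s 2k≤p-3)))
2k≤p∸3⇒k<m k zero          _ (s≤s ())
2k≤p∸3⇒k<m k (suc zero)    _ (s≤s (s≤s (s≤s ())))

mainTheorem7 : (p k : ℕ) → Prime p → 5 ≤ p → 1 ≤ k → 2 ℕ.* k ≤ p ∸ 3 →
    let t = p ∸ 1 ∸ 2 ℕ.* k
        w = λ (n : ℕ) → (+ n) ^ t
    in (+ p) ∣ ((ℤ.-1ℤ ^ k) * (+ 4) ^ (2 ℕ.* k ∸ 1) * E t
       - (w 16 * S p t 0 1 1 64
          + w 2 * S p t 3 8 7 16
          + (w 2 + w 4) * S p t 7 16 15 32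
          + (w 2 + w 4 + w 8) * S p t 15 32 31 64
          + (w 2 + w 4 + w 8 + w 16) * S p t 31 64 1 2))
mainTheorem7 p k p-prime 5≤p 1≤k 2k≤p-3 with prime≥5⇒odd p-prime 5≤p
... | m , refl = mainTheorem7-normalised m k j (2 ℕ.* m ∸ 2 ℕ.* k) p-prime 1≤k m≡k+j+1 t≡2[j+1]
  where
  k<m : suc k ≤ m
  k<m = 2k≤p∸3⇒k<m k m 2k≤p-3 5≤p
  j : ℕ
  j = m ∸ suc k
  m≡k+j+1 : m ≡ k ℕ.+ suc j
  m≡k+j+1 = trans (sym (ℕₚ.m+[n∸m]≡n k<m)) (sym (ℕₚ.+-suc k j))
  t≡2[j+1] : 2 ℕ.* m ∸ 2 ℕ.* k ≡ 2 ℕ.* suc j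
  t≡2[j+1] = trans (sym (ℕₚ.*-distribˡ-∸ 2 m k)) (cong (2 ℕ.*_) (trans (cong (_∸ k) m≡k+j+1) (ℕₚ.m+n∸m≡n k (suc j))))
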